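{- Let $G$ be a meta-chain $k$-gon cactus with $h\ge 2$ $k$-gons, where $k\ge 4$. Then $W_p(G)=6h-6$ if $k=4$; $W_p(G)=8h-8$ if $k=5$; $W_p(G)=11h-8$ if $k=6$; and $W_p(G)=(k+8)h-8$ if $k\ge 7$.
   Context: All graphs are finite, simple and undirected. The Wiener polarity index $W_p(G)$ of a connected graph $G$ is the number of unordered pairs of vertices $\{u,v\}$ with distance $d_G(u,v)=3$. A cactus graph is a connected graph in which no edge lies in more than one cycle. A $k$-gon cactus is a cactus graph in which every block is a cycle of length $k$. A chain $k$-gon cactus is a $k$-gon cactus in which each $k$-gon has at most two cut-vertices and each cut-vertex is shared by exactly two $k$-gons; it is of type 2 if any two cut-vertices lying on a common $k$-gon are at distance at least $2$. A meta-chain $k$-gon cactus with $h$ $k$-gons is obtained from a chain $k$-gon cactus of type 2 with $h$ $k$-gons by expanding each cut-vertex to an edge: a cut-vertex $c$ shared by $k$-gons $A$ and $B$ is replaced by two new adjacent vertices $c_A,c_B$, where $c_A$ takes the place of $c$ in $A$ and $c_B$ takes the place of $c$ in $B$ (so the $k$-gons become vertex-disjoint $k$-cycles joined by bridges). -}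

module Defs where

open import Data.Nat using (ℕ; zero; suc; _+_; _*_; _∸_; _≡ᵇ_; _<ᵇ_; _≤_; _<_; _⊓_; ∣_-_∣)
open import Data.Bool using (Bool; true; false; _∧_; _∨_; not; if_then_else_)
open import Data.Fin using (Fin; toℕ; remQuot)
open import Data.List using (List; map; allFin)
open import Data.Bool.ListAction using (any)
open import Data.Nat.ListAction using (sum)
open import Data.Product using (_×_; _,_)

-- Finite simple graphs on the vertex set Fin n, given by a (symmetric,
-- irreflexive) Boolean adjacency function.

Adjacency : ℕ → Set
Adjacency n = Fin n → Fin n → Bool

reach≤ : ∀ {n} → Adjacency n → ℕ → Fin n → Fin n → Bool
reach≤ adj zero    u v = toℕ u ≡ᵇ toℕ v
reach≤ {n} adj (suc m) u v =
  reach≤ adj m u v ∨ any (λ w → adj u w ∧ reach≤ adj m w v) (allFin n)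

dist3 : ∀ {n} → Adjacency n → Fin n → Fin n → Bool
dist3 adj u v = reach≤ adj 3 u v ∧ not (reach≤ adj 2 u v)

wienerPolarity : ∀ {n} → Adjacency n → ℕ
wienerPolarity {n} adj =
  sum (map (λ u → sum (map (λ v → if (toℕ u <ᵇ toℕ v) ∧ dist3 adj u v then 1 else 0)
                               (allFin n)))
           (allFin n))

-- Vertices: pairs (i , j) with i : Fin h (index of the k-gon along the chain)
-- and j : Fin k (position on the i-th k-cycle), encoded in Fin (h * k) via remQuot.
-- The cut-vertex c_i shared (in the chain cactus) by k-gons i and i+1 sits at
-- position b i on k-gon i and at position a (i+1) on k-gon i+1; after expansion
-- it becomes the bridge (i , b i) -- (i+1 , a (i+1)).
-- (a 0 and b (h-1) play no role.)

cycAdj : ℕ → ℕ → ℕ → Bool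
cycAdj k x y = (suc x ≡ᵇ y) ∨ (suc y ≡ᵇ x)
             ∨ ((x ≡ᵇ 0) ∧ (suc y ≡ᵇ k)) ∨ ((y ≡ᵇ 0) ∧ (suc x ≡ᵇ k))

cycDist : ℕ → ℕ → ℕ → ℕ
cycDist k x y = ∣ x - y ∣ ⊓ (k ∸ ∣ x - y ∣)

metaChainAdj : (k h : ℕ) → (a b : Fin h → Fin k) → Adjacency (h * k)
metaChainAdj k h a b u v with remQuot {h} k u | remQuot {h} k v
... | (i , j) | (i′ , j′) =
      ((toℕ i ≡ᵇ toℕ i′) ∧ cycAdj k (toℕ j) (toℕ j′))
    ∨ ((suc (toℕ i) ≡ᵇ toℕ i′) ∧ (toℕ j ≡ᵇ toℕ (b i)) ∧ (toℕ j′ ≡ᵇ toℕ (a i′)))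
    ∨ ((suc (toℕ i′) ≡ᵇ toℕ i) ∧ (toℕ j′ ≡ᵇ toℕ (b i′)) ∧ (toℕ j ≡ᵇ toℕ (a i)))

-- Type-2 condition of the underlying chain cactus: on every inner k-gon
-- (0 < i < h-1, the ones with two cut-vertices) the two cut-vertices are at
-- distance at least 2.
TypeTwo : (k h : ℕ) → (a b : Fin h → Fin k) → Set
TypeTwo k h a b = (i : Fin h) → 0 < toℕ i → suc (toℕ i) < h →
                  2 ≤ cycDist k (toℕ (a i)) (toℕ (b i))

-- Truncated at 4, the
-- distance between two vertices is explicit: the cycle distance on a common k-gon; for
-- consecutive k-gons, the cycle distance to the exit port, plus one for the bridge, plus the
-- cycle distance from the entry port; and at least 4 for k-gons further apart, since the
-- type-2 condition makes crossing an inner k-gon cost at least two steps.  This formula is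
-- identified with the distance computed by reach≤ by checking that it vanishes exactly on the
-- diagonal, changes by at most one along edges, and can be decreased along an edge while it
-- is at most 3.  Writing s_d for the number of positions at cycle distance d from a fixed one,
-- each vertex then has s₃ partners at distance 3 on its own k-gon, and each of the h − 1
-- bridges joins s₂ s₀ + s₁ s₁ + s₀ s₂ ordered pairs at distance 3 in each direction, so
-- 2 W_p = h k s₃ + 2 (h − 1) (2 s₂ + s₁²).  Finally s₁ = 2, while (s₂, s₃) is (1, 0), (2, 0),
-- (2, 1) and (2, 2) for k = 4, 5, 6 and k ≥ 7.

module Submission where

open import Data.Bool using (Bool; true; false; _∧_; _∨_; not; if_then_else_; T)
open import Data.Bool.ListAction using (any)
open import Data.Bool.Properties using (T-∨; T-∧)
open import Data.Fin using (Fin; zero; suc; toℕ; fromℕ<; remQuot; combine; _↑ˡ_; _↑ʳ_)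
open import Data.Fin.Properties using (toℕ-injective; toℕ<n; toℕ-fromℕ<; remQuot-combine; combine-remQuot)
open import Data.List using (map; tabulate; allFin)
open import Data.List.Membership.Propositional using (lose)
open import Data.List.Membership.Propositional.Properties using (∈-allFin)
open import Data.List.Properties using (map-tabulate)
open import Data.List.Relation.Unary.Any using (satisfied)
open import Data.List.Relation.Unary.Any.Properties using (any⁺; any⁻)
open import Data.Nat
  using (ℕ; zero; suc; _+_; _*_; _∸_; _≤_; _<_; _≤ᵇ_; _<ᵇ_; _≡ᵇ_; z≤n; s≤s; z<s; _⊓_; ∣_-_∣)
import Data.Nat.ListAction as List
open import Data.Nat.Properties
open import Algebra.Properties.CommutativeSemigroup +-commutativeSemigroup using (interchange)
open import Algebra.Properties.Semiring.Sum +-*-semiring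
  using (sum-syntax; sum-cong-≗; ∑-distrib-+; ∑-comm; *-distribˡ-sum; *-distribʳ-sum; sum-replicate-zero)
open import Data.Nat.Tactic.RingSolver using (solve-∀)
open import Data.Product using (∃-syntax; _×_; _,_; proj₁; proj₂; uncurry)
open import Data.Sum using (_⊎_; inj₁; inj₂)
open import Function using (_∘_; _⇔_; mk⇔; Equivalence)
open import Relation.Binary using (tri<; tri≈; tri>)
open import Relation.Binary.PropositionalEquality
open import Relation.Nullary using (Dec; does; yes; no; ¬_; contradiction)
open import Relation.Nullary.Decidable using (dec-true; dec-false; does-⇔)
open import Relation.Nullary.Reflects using (det; fromEquivalence)

open import Defs

-- Indicators and finite sums

T-∨ˡ : ∀ {a} b → T a → T (a ∨ b)
T-∨ˡ b t = Equivalence.from T-∨ (inj₁ t)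

T-∨ʳ : ∀ a {b} → T b → T (a ∨ b)
T-∨ʳ a t = Equivalence.from (T-∨ {a}) (inj₂ t)

𝟙 : Bool → ℕ
𝟙 b = if b then 1 else 0

-- m ≡ᵇ n, m <ᵇ n and m ≤ᵇ n are definitionally does (m ≟ n), does (m <? n) and does (m ≤? n);
-- this is what lets dec-true and dec-false rewrite them throughout.
𝟙-yes : ∀ {A : Set} (a? : Dec A) → A → 𝟙 (does a?) ≡ 1
𝟙-yes a? a = cong 𝟙 (dec-true a? a)

𝟙-no : ∀ {A : Set} (a? : Dec A) → ¬ A → 𝟙 (does a?) ≡ 0
𝟙-no a? ¬a = cong 𝟙 (dec-false a? ¬a)

𝟙-complement : ∀ {A B : Set} (a? : Dec A) (b? : Dec B) → B ⇔ (¬ A) → 𝟙 (does a?) + 𝟙 (does b?) ≡ 1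
𝟙-complement (yes a)  b? B⇔¬A = cong suc (𝟙-no b? (λ b → Equivalence.to B⇔¬A b a))
𝟙-complement (no ¬a) b? B⇔¬A = 𝟙-yes b? (Equivalence.from B⇔¬A ¬a)

∑-const : ∀ n c → ∑[ i < n ] c ≡ n * c
∑-const zero    c = refl
∑-const (suc n) c = cong (c +_) (∑-const n c)

∑-distrib-+₃ : ∀ n (f g h : Fin n → ℕ) →
  ∑[ i < n ] (f i + g i + h i) ≡ ∑[ i < n ] f i + ∑[ i < n ] g i + ∑[ i < n ] h i
∑-distrib-+₃ n f g h = trans (∑-distrib-+ {n} (λ i → f i + g i) h) (cong (_+ ∑[ i < n ] h i) (∑-distrib-+ {n} f g))

∑-if : ∀ n c (P : Fin n → Bool) → ∑[ i < n ] (if P i then c else 0) ≡ c * ∑[ i < n ] 𝟙 (P i)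
∑-if n c P = trans (sum-cong-≗ {n} (if-then-else-0 ∘ P)) (sym (*-distribˡ-sum c (𝟙 ∘ P)))
  where
  if-then-else-0 : ∀ b → (if b then c else 0) ≡ c * 𝟙 b
  if-then-else-0 true  = sym (*-identityʳ c)
  if-then-else-0 false = sym (*-zeroʳ c)

∑-↑ : ∀ m n (f : Fin (m + n) → ℕ) → ∑[ u < m + n ] f u ≡ ∑[ i < m ] f (i ↑ˡ n) + ∑[ j < n ] f (m ↑ʳ j)
∑-↑ zero    n f = refl
∑-↑ (suc m) n f = trans (cong (f zero +_) (∑-↑ m n (f ∘ suc))) (sym (+-assoc (f zero) _ _))

∑-combine : ∀ m n (f : Fin (m * n) → ℕ) → ∑[ u < m * n ] f u ≡ ∑[ i < m ] ∑[ j < n ] f (combine i j)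
∑-combine zero    n f = refl
∑-combine (suc m) n f = trans (∑-↑ n (m * n) f) (cong (∑[ j < n ] f (j ↑ˡ (m * n)) +_) (∑-combine m n (f ∘ (n ↑ʳ_))))

∑-remQuot : ∀ m n (f : Fin m × Fin n → ℕ) → ∑[ u < m * n ] f (remQuot n u) ≡ ∑[ i < m ] ∑[ j < n ] f (i , j)
∑-remQuot m n f = trans (∑-combine m n (f ∘ remQuot n))
  (sum-cong-≗ {m} (λ i → sum-cong-≗ {n} (λ j → cong f (remQuot-combine i j))))

remQuot-injective : ∀ m n {u v : Fin (m * n)} → remQuot {m} n u ≡ remQuot n v → u ≡ v
remQuot-injective m n {u} {v} eq =
  trans (sym (combine-remQuot {m} n u)) (trans (cong (uncurry combine) eq) (combine-remQuot {m} n v))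

listSum-allFin : ∀ n (f : Fin n → ℕ) → List.sum (map f (allFin n)) ≡ ∑[ i < n ] f i
listSum-allFin n f = trans (cong List.sum (map-tabulate (λ i → i) f)) (listSum-tabulate n f)
  where
  listSum-tabulate : ∀ n (f : Fin n → ℕ) → List.sum (tabulate f) ≡ ∑[ i < n ] f i
  listSum-tabulate zero    f = refl
  listSum-tabulate (suc n) f = cong (f zero +_) (listSum-tabulate n (f ∘ suc))

∑-𝟙[i≡t] : ∀ n t → ∑[ i < n ] 𝟙 (toℕ i ≡ᵇ t) ≡ 𝟙 (t <ᵇ n)
∑-𝟙[i≡t] zero    t       = refl
∑-𝟙[i≡t] (suc n) zero    = cong suc (sum-replicate-zero n)
∑-𝟙[i≡t] (suc n) (suc t) = ∑-𝟙[i≡t] n t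

∑-𝟙[i+e≡c] : ∀ n {c} e → c < n → ∑[ i < n ] 𝟙 (toℕ i + e ≡ᵇ c) ≡ 𝟙 (e ≤ᵇ c)
∑-𝟙[i+e≡c] n {c} e c<n with e ≤? c
... | yes e≤c = begin
  ∑[ i < n ] 𝟙 (toℕ i + e ≡ᵇ c)
    ≡⟨ sum-cong-≗ {n} (λ i → cong 𝟙 (does-⇔ i+e≡c⇔ (toℕ i + e ≟ c) (toℕ i ≟ c ∸ e))) ⟩
  ∑[ i < n ] 𝟙 (toℕ i ≡ᵇ c ∸ e) ≡⟨ ∑-𝟙[i≡t] n (c ∸ e) ⟩
  𝟙 (c ∸ e <ᵇ n)                ≡⟨ 𝟙-yes (c ∸ e <? n) (≤-<-trans (m∸n≤m c e) c<n) ⟩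
  1                             ≡⟨ 𝟙-yes (e ≤? c) e≤c ⟨
  𝟙 (e ≤ᵇ c)                    ∎
  where
  open ≡-Reasoning
  i+e≡c⇔ : ∀ {i} → (i + e ≡ c) ⇔ (i ≡ c ∸ e)
  i+e≡c⇔ {i} = mk⇔ (λ eq → trans (sym (m+n∸n≡m i e)) (cong (_∸ e) eq))
                   (λ eq → trans (cong (_+ e) eq) (m∸n+n≡m e≤c))
... | no e≰c =
  trans (sum-cong-≗ {n} (λ i → 𝟙-no (toℕ i + e ≟ c) (λ eq → e≰c (≤-trans (m≤n+m e (toℕ i)) (≤-reflexive eq)))))
        (trans (sum-replicate-zero n) (sym (𝟙-no (e ≤? c) e≰c)))

∑-𝟙[i+1<n] : ∀ n → ∑[ i < n ] 𝟙 (suc (toℕ i) <ᵇ n) ≡ n ∸ 1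
∑-𝟙[i+1<n] zero          = refl
∑-𝟙[i+1<n] (suc zero)    = refl
∑-𝟙[i+1<n] (suc (suc n)) = cong suc (∑-𝟙[i+1<n] (suc n))

∑-𝟙[1≤i] : ∀ n → ∑[ i < n ] 𝟙 (1 ≤ᵇ toℕ i) ≡ n ∸ 1
∑-𝟙[1≤i] zero    = refl
∑-𝟙[1≤i] (suc n) = trans (∑-const n 1) (*-identityʳ n)

∑∑-unordered : ∀ n (P : Fin n → Fin n → Bool) → (∀ u v → P u v ≡ P v u) → (∀ u → P u u ≡ false) →
  let N = ∑[ u < n ] ∑[ v < n ] 𝟙 ((toℕ u <ᵇ toℕ v) ∧ P u v) in
  N + N ≡ ∑[ u < n ] ∑[ v < n ] 𝟙 (P u v)
∑∑-unordered n P P-comm P-irrefl = begin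
  N + N
    ≡⟨ cong (N +_) swap ⟩
  N + ∑[ u < n ] ∑[ v < n ] 𝟙 ((toℕ v <ᵇ toℕ u) ∧ P u v)
    ≡⟨ ∑-distrib-+ {n} (λ u → ∑[ v < n ] 𝟙 ((toℕ u <ᵇ toℕ v) ∧ P u v)) _ ⟨
  ∑[ u < n ] (∑[ v < n ] 𝟙 ((toℕ u <ᵇ toℕ v) ∧ P u v) + ∑[ v < n ] 𝟙 ((toℕ v <ᵇ toℕ u) ∧ P u v))
    ≡⟨ sum-cong-≗ {n} (λ u → sym (∑-distrib-+ {n} (λ v → 𝟙 ((toℕ u <ᵇ toℕ v) ∧ P u v)) _)) ⟩
  ∑[ u < n ] ∑[ v < n ] (𝟙 ((toℕ u <ᵇ toℕ v) ∧ P u v) + 𝟙 ((toℕ v <ᵇ toℕ u) ∧ P u v))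
    ≡⟨ sum-cong-≗ {n} (λ u → sum-cong-≗ {n} (λ v → split u v)) ⟩
  ∑[ u < n ] ∑[ v < n ] 𝟙 (P u v) ∎
  where
  open ≡-Reasoning
  N = ∑[ u < n ] ∑[ v < n ] 𝟙 ((toℕ u <ᵇ toℕ v) ∧ P u v)
  swap : N ≡ ∑[ u < n ] ∑[ v < n ] 𝟙 ((toℕ v <ᵇ toℕ u) ∧ P u v)
  swap = trans (sum-cong-≗ {n} (λ u → sum-cong-≗ {n} (λ v →
                 cong (λ p → 𝟙 ((toℕ u <ᵇ toℕ v) ∧ p)) (P-comm u v))))
               (∑-comm (λ u v → 𝟙 ((toℕ u <ᵇ toℕ v) ∧ P v u)))
  split : ∀ u v → 𝟙 ((toℕ u <ᵇ toℕ v) ∧ P u v) + 𝟙 ((toℕ v <ᵇ toℕ u) ∧ P u v) ≡ 𝟙 (P u v)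
  split u v with <-cmp (toℕ u) (toℕ v)
  ... | tri< u<v _ v≮u rewrite dec-true (toℕ u <? toℕ v) u<v | dec-false (toℕ v <? toℕ u) v≮u = +-identityʳ _
  ... | tri> u≮v _ v<u rewrite dec-false (toℕ u <? toℕ v) u≮v | dec-true (toℕ v <? toℕ u) v<u = refl
  ... | tri≈ u≮v u≡v _ rewrite toℕ-injective u≡v | P-irrefl v | dec-false (toℕ v <? toℕ v) u≮v = refl

-- Reachability from a distance function

T-any-allFin : ∀ {n} (p : Fin n → Bool) → T (any p (allFin n)) ⇔ (∃[ w ] T (p w))
T-any-allFin {n} p = mk⇔ (satisfied ∘ any⁻ p (allFin n)) (λ (w , pw) → any⁺ p (lose (∈-allFin w) pw))

module ReachViaDistance {n : ℕ} (adj : Adjacency n) (D : Fin n → Fin n → ℕ) (M : ℕ)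
  (D≡0⇒≡ : ∀ {u v} → D u v ≡ 0 → u ≡ v)
  (D-refl : ∀ u → D u u ≡ 0)
  (D-edge : ∀ {u w} v → T (adj u w) → D u v ≤ suc (D w v))
  (D-descent : ∀ {u v} → 0 < D u v → D u v ≤ M → ∃[ w ] T (adj u w) × suc (D w v) ≡ D u v)
  where

  T-reach≤⇔ : ∀ {m} → m ≤ M → ∀ u v → T (reach≤ adj m u v) ⇔ D u v ≤ m
  T-reach≤⇔ {zero} _ u v = mk⇔ to from
    where
    to : T (toℕ u ≡ᵇ toℕ v) → D u v ≤ 0
    to eq = ≤-reflexive (subst (λ x → D x v ≡ 0) (sym (toℕ-injective (≡ᵇ⇒≡ _ _ eq))) (D-refl v))
    from : D u v ≤ 0 → T (toℕ u ≡ᵇ toℕ v)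
    from D≤0 = ≡⇒≡ᵇ _ _ (cong toℕ (D≡0⇒≡ (n≤0⇒n≡0 D≤0)))
  T-reach≤⇔ {suc m} 1+m≤M u v = mk⇔ to from
    where
    IH : ∀ w → T (reach≤ adj m w v) ⇔ D w v ≤ m
    IH w = T-reach≤⇔ (≤-trans (n≤1+n m) 1+m≤M) w v
    to : T (reach≤ adj (suc m) u v) → D u v ≤ suc m
    to r with Equivalence.to T-∨ r
    ... | inj₁ r′ = m≤n⇒m≤1+n (Equivalence.to (IH u) r′)
    ... | inj₂ r′ with Equivalence.to (T-any-allFin _) r′
    ...   | w , uw∧rw with Equivalence.to T-∧ uw∧rw
    ...     | uw , rw = ≤-trans (D-edge v uw) (s≤s (Equivalence.to (IH w) rw))
    from : D u v ≤ suc m → T (reach≤ adj (suc m) u v)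
    from D≤ with m≤n⇒m<n∨m≡n D≤
    ... | inj₁ D≤m = Equivalence.from T-∨ (inj₁ (Equivalence.from (IH u) (m<1+n⇒m≤n D≤m)))
    ... | inj₂ D≡ with D-descent (subst (0 <_) (sym D≡) z<s) (subst (_≤ M) (sym D≡) 1+m≤M)
    ...   | w , uw , Dw = Equivalence.from T-∨ (inj₂ (Equivalence.from (T-any-allFin _)
              (w , Equivalence.from T-∧ (uw , Equivalence.from (IH w) (≤-reflexive (suc-injective (trans Dw D≡)))))))

  reach≤≡ : ∀ {m} → m ≤ M → ∀ u v → reach≤ adj m u v ≡ (D u v ≤ᵇ m)
  reach≤≡ m≤M u v = det (fromEquivalence to from) (≤ᵇ-reflects-≤ (D u v) _)
    where open Equivalence (T-reach≤⇔ m≤M u v)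

[d≤3]∧¬[d≤2] : ∀ d → (d ≤ᵇ 3) ∧ not (d ≤ᵇ 2) ≡ (d ≡ᵇ 3)
[d≤3]∧¬[d≤2] 0 = refl
[d≤3]∧¬[d≤2] 1 = refl
[d≤3]∧¬[d≤2] 2 = refl
[d≤3]∧¬[d≤2] 3 = refl
[d≤3]∧¬[d≤2] (suc (suc (suc (suc _)))) = refl

-- Distance on a cycle

-- cycDist k x y unfolds to arcDist k ∣ x - y ∣.
arcDist : ℕ → ℕ → ℕ
arcDist k δ = δ ⊓ (k ∸ δ)

arcDist-reflect : ∀ {k δ} → δ ≤ k → arcDist k (k ∸ δ) ≡ arcDist k δ
arcDist-reflect {k} {δ} δ≤k = begin
  (k ∸ δ) ⊓ (k ∸ (k ∸ δ)) ≡⟨ cong ((k ∸ δ) ⊓_) (m∸[m∸n]≡n δ≤k) ⟩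
  (k ∸ δ) ⊓ δ             ≡⟨ ⊓-comm (k ∸ δ) δ ⟩
  δ ⊓ (k ∸ δ)             ∎
  where open ≡-Reasoning

arcDist-lipschitz : ∀ k {δ δ′} → δ ≤ suc δ′ → δ′ ≤ suc δ → arcDist k δ ≤ suc (arcDist k δ′)
arcDist-lipschitz k {δ} {δ′} δ≤ δ′≤ = ⊓-glb (≤-trans (m⊓n≤m δ (k ∸ δ)) δ≤)
  (≤-trans (m⊓n≤n δ (k ∸ δ)) (≤-trans (∸-monoʳ-≤ (suc k) δ′≤) (suc[m]∸n≤suc[m∸n] k δ′)))
  where
  suc[m]∸n≤suc[m∸n] : ∀ m n → suc m ∸ n ≤ suc (m ∸ n)
  suc[m]∸n≤suc[m∸n] m       zero    = ≤-refl
  suc[m]∸n≤suc[m∸n] zero    (suc n) = ≤-trans (≤-reflexive (0∸n≡0 n)) z≤n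
  suc[m]∸n≤suc[m∸n] (suc m) (suc n) = suc[m]∸n≤suc[m∸n] m n

arcDist-suc-lipschitz : ∀ k δ → arcDist k δ ≤ suc (arcDist k (suc δ)) × arcDist k (suc δ) ≤ suc (arcDist k δ)
arcDist-suc-lipschitz k δ =
  arcDist-lipschitz k (m≤n⇒m≤1+n (n≤1+n δ)) ≤-refl , arcDist-lipschitz k ≤-refl (m≤n⇒m≤1+n (n≤1+n δ))

arcDist-suc≡suc : ∀ {k δ} → suc δ ≤ k ∸ suc δ → arcDist k (suc δ) ≡ suc (arcDist k δ)
arcDist-suc≡suc {k} {δ} h = begin
  suc δ ⊓ (k ∸ suc δ) ≡⟨ m≤n⇒m⊓n≡m h ⟩
  suc δ               ≡⟨ cong suc (m≤n⇒m⊓n≡m δ≤k∸δ) ⟨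
  suc (δ ⊓ (k ∸ δ))   ∎
  where
  open ≡-Reasoning
  δ≤k∸δ : δ ≤ k ∸ δ
  δ≤k∸δ = ≤-trans (n≤1+n δ) (≤-trans h (∸-monoʳ-≤ k (n≤1+n δ)))

arcDist≡suc-arcDist-suc : ∀ {k δ} → δ < k → k ∸ δ < δ → arcDist k δ ≡ suc (arcDist k (suc δ))
arcDist≡suc-arcDist-suc {k} {δ} δ<k h = begin
  δ ⊓ (k ∸ δ)               ≡⟨ m≥n⇒m⊓n≡n (<⇒≤ h) ⟩
  k ∸ δ                     ≡⟨ +-∸-assoc 1 δ<k ⟩
  suc (k ∸ suc δ)           ≡⟨ cong suc (m≥n⇒m⊓n≡n k∸sδ≤sδ) ⟨
  suc (suc δ ⊓ (k ∸ suc δ)) ∎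
  where
  open ≡-Reasoning
  k∸sδ≤sδ : k ∸ suc δ ≤ suc δ
  k∸sδ≤sδ = ≤-trans (∸-monoʳ-≤ k (n≤1+n δ)) (≤-trans (<⇒≤ h) (n≤1+n δ))

∣x-z∣<k : ∀ {k x z} → x < k → z < k → ∣ x - z ∣ < k
∣x-z∣<k {k} {x} {z} x<k z<k = ≤-<-trans (∣m-n∣≤m⊔n x z) (⊔-lub x<k z<k)

∣suc[x]-z∣≡suc∣x-z∣ : ∀ {x z} → z ≤ x → ∣ suc x - z ∣ ≡ suc ∣ x - z ∣
∣suc[x]-z∣≡suc∣x-z∣ {x} {zero}  _         = cong suc (sym (∣-∣-identityʳ x))
∣suc[x]-z∣≡suc∣x-z∣ {suc x} {suc z} (s≤s z≤x) = ∣suc[x]-z∣≡suc∣x-z∣ z≤x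

∣x-z∣≡suc∣suc[x]-z∣ : ∀ {x z} → x < z → ∣ x - z ∣ ≡ suc ∣ suc x - z ∣
∣x-z∣≡suc∣suc[x]-z∣ {zero}  {suc z} _         = refl
∣x-z∣≡suc∣suc[x]-z∣ {suc x} {suc z} (s≤s x<z) = ∣x-z∣≡suc∣suc[x]-z∣ x<z

cycDist-comm : ∀ k x y → cycDist k x y ≡ cycDist k y x
cycDist-comm k x y = cong (arcDist k) (∣-∣-comm x y)

cycDist-self : ∀ k x → cycDist k x x ≡ 0
cycDist-self k x = cong (arcDist k) (∣n-n∣≡0 x)

cycDist≡0⇒≡ : ∀ {k x z} → x < k → z < k → cycDist k x z ≡ 0 → x ≡ z
cycDist≡0⇒≡ {k} {x} {z} x<k z<k d≡0 with ⊓-sel ∣ x - z ∣ (k ∸ ∣ x - z ∣)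
... | inj₁ d≡δ = ∣m-n∣≡0⇒m≡n (trans (sym d≡δ) d≡0)
... | inj₂ d≡k∸δ = contradiction (trans (sym d≡k∸δ) d≡0) (m>n⇒m∸n≢0 (∣x-z∣<k x<k z<k))

cycDist-half : ∀ {k x z} → x < k → z < k → cycDist k x z + cycDist k x z ≤ k
cycDist-half {k} {x} {z} x<k z<k = begin
  arcDist k δ + arcDist k δ ≤⟨ +-mono-≤ (m⊓n≤m δ (k ∸ δ)) (m⊓n≤n δ (k ∸ δ)) ⟩
  δ + (k ∸ δ)         ≡⟨ m+[n∸m]≡n (<⇒≤ (∣x-z∣<k x<k z<k)) ⟩
  k                   ∎
  where
  open ≤-Reasoning
  δ = ∣ x - z ∣

cycDist-suc-lipschitz : ∀ k x z → cycDist k x z ≤ suc (cycDist k (suc x) z) × cycDist k (suc x) z ≤ suc (cycDist k x z)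
cycDist-suc-lipschitz k x z with ≤-<-connex z x
... | inj₁ z≤x rewrite ∣suc[x]-z∣≡suc∣x-z∣ z≤x = arcDist-suc-lipschitz k ∣ x - z ∣
... | inj₂ x<z rewrite ∣x-z∣≡suc∣suc[x]-z∣ x<z =
      let (p , q) = arcDist-suc-lipschitz k ∣ suc x - z ∣ in q , p

cycDist-last : ∀ {m z} → z ≤ m → cycDist (suc m) m z ≡ arcDist (suc m) (suc z)
cycDist-last {m} {z} z≤m = begin
  arcDist (suc m) ∣ m - z ∣          ≡⟨ cong (arcDist (suc m)) (m≤n⇒∣n-m∣≡n∸m z≤m) ⟩
  arcDist (suc m) (suc m ∸ suc z)    ≡⟨ arcDist-reflect (s≤s z≤m) ⟩
  arcDist (suc m) (suc z)            ∎
  where open ≡-Reasoning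

cycAdj⇒ : ∀ {k x y} → T (cycAdj k x y) →
          suc x ≡ y ⊎ suc y ≡ x ⊎ (x ≡ 0 × suc y ≡ k) ⊎ (y ≡ 0 × suc x ≡ k)
cycAdj⇒ {k} {x} {y} adj with Equivalence.to (T-∨ {suc x ≡ᵇ y}) adj
... | inj₁ e = inj₁ (≡ᵇ⇒≡ _ _ e)
... | inj₂ adj′ with Equivalence.to (T-∨ {suc y ≡ᵇ x}) adj′
...   | inj₁ e = inj₂ (inj₁ (≡ᵇ⇒≡ _ _ e))
...   | inj₂ adj″ with Equivalence.to (T-∨ {(x ≡ᵇ 0) ∧ (suc y ≡ᵇ k)}) adj″
...     | inj₁ w = let (e₁ , e₂) = Equivalence.to (T-∧ {x ≡ᵇ 0}) w in
                   inj₂ (inj₂ (inj₁ (≡ᵇ⇒≡ x 0 e₁ , ≡ᵇ⇒≡ (suc y) k e₂)))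
...     | inj₂ w = let (e₁ , e₂) = Equivalence.to (T-∧ {y ≡ᵇ 0}) w in
                   inj₂ (inj₂ (inj₂ (≡ᵇ⇒≡ y 0 e₁ , ≡ᵇ⇒≡ (suc x) k e₂)))

cycDist-edge : ∀ {k x y z} → z < k → T (cycAdj k x y) → cycDist k x z ≤ suc (cycDist k y z)
cycDist-edge {k} {x} {y} {z} z<k adj with cycAdj⇒ {k} {x} {y} adj
... | inj₁ refl                       = proj₁ (cycDist-suc-lipschitz k x z)
... | inj₂ (inj₁ refl)                = proj₂ (cycDist-suc-lipschitz k y z)
... | inj₂ (inj₂ (inj₁ (refl , refl))) rewrite cycDist-last (m<1+n⇒m≤n z<k) = proj₁ (arcDist-suc-lipschitz k z)
... | inj₂ (inj₂ (inj₂ (refl , refl))) rewrite cycDist-last (m<1+n⇒m≤n z<k) = proj₂ (arcDist-suc-lipschitz k z)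

cycAdj-suc : ∀ k x → T (cycAdj k x (suc x))
cycAdj-suc k x = T-∨ˡ _ (≡⇒≡ᵇ (suc x) (suc x) refl)

cycAdj-pred : ∀ k y → T (cycAdj k (suc y) y)
cycAdj-pred k y = T-∨ʳ (suc (suc y) ≡ᵇ y) (T-∨ˡ _ (≡⇒≡ᵇ (suc y) (suc y) refl))

cycAdj-0-last : ∀ m → T (cycAdj (suc m) 0 m)
cycAdj-0-last m = T-∨ʳ (1 ≡ᵇ m) (T-∨ˡ _ (≡⇒≡ᵇ m m refl))

cycAdj-last-0 : ∀ m → T (cycAdj (suc m) m 0)
cycAdj-last-0 m = T-∨ʳ (1 ≡ᵇ m) (T-∨ʳ ((m ≡ᵇ 0) ∧ (0 ≡ᵇ m)) (≡⇒≡ᵇ m m refl))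

CycleDescent : ℕ → ℕ → ℕ → Set
CycleDescent k x z = ∃[ y ] y < k × T (cycAdj k x y) × suc (cycDist k y z) ≡ cycDist k x z

cycDist-descent-< : ∀ {k x z} → x < z → z < k → CycleDescent k x z
cycDist-descent-< {k} {x} {z} x<z z<k with ∣ x - z ∣ ≤? k ∸ ∣ x - z ∣
... | yes δ≤ = suc x , ≤-<-trans x<z z<k , cycAdj-suc k x ,
  trans (sym (arcDist-suc≡suc (subst (λ δ → δ ≤ k ∸ δ) δ≡ δ≤))) (cong (arcDist k) (sym δ≡))
  where δ≡ = ∣x-z∣≡suc∣suc[x]-z∣ x<z
cycDist-descent-< {suc m} {zero} {z} _ z<k | no δ≰ =
  m , ≤-refl , cycAdj-0-last m ,
  trans (cong suc (cycDist-last (m<1+n⇒m≤n z<k))) (sym (arcDist≡suc-arcDist-suc z<k (≰⇒> δ≰)))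
cycDist-descent-< {k} {suc x} {z} x<z z<k | no δ≰ =
  x , <-trans (n<1+n x) (<-trans x<z z<k) , cycAdj-pred k x ,
  trans (cong (suc ∘ arcDist k) (∣x-z∣≡suc∣suc[x]-z∣ (<⇒≤ x<z)))
        (sym (arcDist≡suc-arcDist-suc (∣x-z∣<k (<-trans x<z z<k) z<k) (≰⇒> δ≰)))

cycDist-descent-last : ∀ {m z} → z < m → suc m ∸ ∣ m - z ∣ < ∣ m - z ∣ → CycleDescent (suc m) m z
cycDist-descent-last {m} {z} z<m ε<δ =
  0 , z<s , cycAdj-last-0 m , trans (sym (arcDist-suc≡suc sz≤)) (sym (cycDist-last z≤m))
  where
  open ≡-Reasoning
  z≤m = <⇒≤ z<m
  δ≡ : ∣ m - z ∣ ≡ m ∸ z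
  δ≡ = m≤n⇒∣n-m∣≡n∸m z≤m
  ε≡ : suc m ∸ ∣ m - z ∣ ≡ suc z
  ε≡ = begin
    suc m ∸ ∣ m - z ∣   ≡⟨ cong (suc m ∸_) δ≡ ⟩
    suc m ∸ (m ∸ z)     ≡⟨ +-∸-assoc 1 (m∸n≤m m z) ⟩
    suc (m ∸ (m ∸ z))   ≡⟨ cong suc (m∸[m∸n]≡n z≤m) ⟩
    suc z               ∎
  sz≤ : suc z ≤ suc m ∸ suc z
  sz≤ = <⇒≤ (subst₂ _<_ ε≡ δ≡ ε<δ)

cycDist-descent-> : ∀ {k x z} → z < x → x < k → CycleDescent k x z
cycDist-descent-> {k} {suc x} {z} z<x x<k with ∣ suc x - z ∣ ≤? k ∸ ∣ suc x - z ∣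
... | yes δ≤ = x , <-trans (n<1+n x) x<k , cycAdj-pred k x ,
  trans (sym (arcDist-suc≡suc (subst (λ δ → δ ≤ k ∸ δ) δ≡ δ≤))) (cong (arcDist k) (sym δ≡))
  where δ≡ = ∣suc[x]-z∣≡suc∣x-z∣ (m<1+n⇒m≤n z<x)
... | no δ≰ with suc (suc x) <? k
...   | yes sx<k = suc (suc x) , sx<k , cycAdj-suc k (suc x) ,
  trans (cong (suc ∘ arcDist k) (∣suc[x]-z∣≡suc∣x-z∣ (<⇒≤ z<x)))
        (sym (arcDist≡suc-arcDist-suc (∣x-z∣<k x<k (<-trans z<x x<k)) (≰⇒> δ≰)))
...   | no sx≮k with ≤-antisym x<k (≮⇒≥ sx≮k)
...     | refl = cycDist-descent-last z<x (≰⇒> δ≰)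

cycDist-descent : ∀ {k x z} → x < k → z < k → 0 < cycDist k x z → CycleDescent k x z
cycDist-descent {k} {x} {z} x<k z<k d>0 with <-cmp x z
... | tri< x<z _ _ = cycDist-descent-< x<z z<k
... | tri> _ _ z<x = cycDist-descent-> z<x x<k
... | tri≈ _ refl _ = contradiction (cycDist-self k x) (>⇒≢ d>0)

-- Spheres on a cycle

𝟙[∣c-y∣≡e] : ∀ {e} c y → 1 ≤ e → 𝟙 (∣ c - y ∣ ≡ᵇ e) ≡ 𝟙 (y ≡ᵇ c + e) + 𝟙 (y + e ≡ᵇ c)
𝟙[∣c-y∣≡e] {e} c y 1≤e with ≤-<-connex c y
... | inj₁ c≤y = begin
  𝟙 (∣ c - y ∣ ≡ᵇ e)                 ≡⟨ cong (λ δ → 𝟙 (δ ≡ᵇ e)) (m≤n⇒∣m-n∣≡n∸m c≤y) ⟩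
  𝟙 (y ∸ c ≡ᵇ e)                     ≡⟨ cong 𝟙 (does-⇔ y∸c≡e⇔ (y ∸ c ≟ e) (y ≟ c + e)) ⟩
  𝟙 (y ≡ᵇ c + e)                     ≡⟨ +-identityʳ _ ⟨
  𝟙 (y ≡ᵇ c + e) + 0                 ≡⟨ cong (𝟙 (y ≡ᵇ c + e) +_) (𝟙-no (y + e ≟ c) y+e≢c) ⟨
  𝟙 (y ≡ᵇ c + e) + 𝟙 (y + e ≡ᵇ c)    ∎
  where
  open ≡-Reasoning
  y∸c≡e⇔ : (y ∸ c ≡ e) ⇔ (y ≡ c + e)
  y∸c≡e⇔ = mk⇔ (λ eq → trans (sym (m+[n∸m]≡n c≤y)) (cong (c +_) eq))
               (λ eq → trans (cong (_∸ c) eq) (m+n∸m≡n c e))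
  y+e≢c : y + e ≢ c
  y+e≢c eq = <⇒≱ (≤-<-trans c≤y (m<m+n y 1≤e)) (≤-reflexive eq)
... | inj₂ y<c = begin
  𝟙 (∣ c - y ∣ ≡ᵇ e)                 ≡⟨ cong (λ δ → 𝟙 (δ ≡ᵇ e)) (m≤n⇒∣n-m∣≡n∸m (<⇒≤ y<c)) ⟩
  𝟙 (c ∸ y ≡ᵇ e)                     ≡⟨ cong 𝟙 (does-⇔ c∸y≡e⇔ (c ∸ y ≟ e) (y + e ≟ c)) ⟩
  𝟙 (y + e ≡ᵇ c)                     ≡⟨ cong (_+ 𝟙 (y + e ≡ᵇ c)) (𝟙-no (y ≟ c + e) y≢c+e) ⟨
  𝟙 (y ≡ᵇ c + e) + 𝟙 (y + e ≡ᵇ c)    ∎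
  where
  open ≡-Reasoning
  c∸y≡e⇔ : (c ∸ y ≡ e) ⇔ (y + e ≡ c)
  c∸y≡e⇔ = mk⇔ (λ eq → trans (cong (y +_) (sym eq)) (m+[n∸m]≡n (<⇒≤ y<c)))
               (λ eq → trans (cong (_∸ y) (sym eq)) (m+n∸m≡n y e))
  y≢c+e : y ≢ c + e
  y≢c+e eq = <⇒≱ (<-≤-trans y<c (m≤m+n c e)) (≤-reflexive (sym eq))

∑-𝟙[∣c-y∣≡e] : ∀ k {c e} → 1 ≤ e → c < k →
  ∑[ y < k ] 𝟙 (∣ c - toℕ y ∣ ≡ᵇ e) ≡ 𝟙 (c + e <ᵇ k) + 𝟙 (e ≤ᵇ c)
∑-𝟙[∣c-y∣≡e] k {c} {e} 1≤e c<k = begin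
  ∑[ y < k ] 𝟙 (∣ c - toℕ y ∣ ≡ᵇ e)
    ≡⟨ sum-cong-≗ {k} (λ y → 𝟙[∣c-y∣≡e] c (toℕ y) 1≤e) ⟩
  ∑[ y < k ] (𝟙 (toℕ y ≡ᵇ c + e) + 𝟙 (toℕ y + e ≡ᵇ c))
    ≡⟨ ∑-distrib-+ {k} (λ y → 𝟙 (toℕ y ≡ᵇ c + e)) _ ⟩
  ∑[ y < k ] 𝟙 (toℕ y ≡ᵇ c + e) + ∑[ y < k ] 𝟙 (toℕ y + e ≡ᵇ c)
    ≡⟨ cong₂ _+_ (∑-𝟙[i≡t] k (c + e)) (∑-𝟙[i+e≡c] k e c<k) ⟩
  𝟙 (c + e <ᵇ k) + 𝟙 (e ≤ᵇ c) ∎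
  where open ≡-Reasoning

𝟙[arcDist≡d]-< : ∀ {k δ d} → d + d < k → δ < k → 𝟙 (arcDist k δ ≡ᵇ d) ≡ 𝟙 (δ ≡ᵇ d) + 𝟙 (δ ≡ᵇ k ∸ d)
𝟙[arcDist≡d]-< {k} {δ} {d} 2d<k δ<k with δ ≤? k ∸ δ
... | yes δ≤k∸δ = begin
  𝟙 (δ ⊓ (k ∸ δ) ≡ᵇ d)             ≡⟨ cong (λ x → 𝟙 (x ≡ᵇ d)) (m≤n⇒m⊓n≡m δ≤k∸δ) ⟩
  𝟙 (δ ≡ᵇ d)                       ≡⟨ +-identityʳ _ ⟨
  𝟙 (δ ≡ᵇ d) + 0                   ≡⟨ cong (𝟙 (δ ≡ᵇ d) +_) (𝟙-no (δ ≟ k ∸ d) δ≢k∸d) ⟨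
  𝟙 (δ ≡ᵇ d) + 𝟙 (δ ≡ᵇ k ∸ d)      ∎
  where
  open ≡-Reasoning
  δ≢k∸d : δ ≢ k ∸ d
  δ≢k∸d refl = <⇒≱ 2d<k (≤-trans (≤-reflexive (sym (m∸n+n≡m d≤k)))
    (+-monoˡ-≤ d (subst (k ∸ d ≤_) (m∸[m∸n]≡n d≤k) δ≤k∸δ)))
    where d≤k = ≤-trans (m≤m+n d d) (<⇒≤ 2d<k)
... | no δ≰k∸δ = begin
  𝟙 (δ ⊓ (k ∸ δ) ≡ᵇ d)             ≡⟨ cong (λ x → 𝟙 (x ≡ᵇ d)) (m≥n⇒m⊓n≡n (<⇒≤ k∸δ<δ)) ⟩
  𝟙 (k ∸ δ ≡ᵇ d)                   ≡⟨ cong 𝟙 (does-⇔ k∸δ≡d⇔ (k ∸ δ ≟ d) (δ ≟ k ∸ d)) ⟩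
  𝟙 (δ ≡ᵇ k ∸ d)                   ≡⟨ cong (_+ 𝟙 (δ ≡ᵇ k ∸ d)) (𝟙-no (δ ≟ d) δ≢d) ⟨
  𝟙 (δ ≡ᵇ d) + 𝟙 (δ ≡ᵇ k ∸ d)      ∎
  where
  open ≡-Reasoning
  k∸δ<δ = ≰⇒> δ≰k∸δ
  d≤k = ≤-trans (m≤m+n d d) (<⇒≤ 2d<k)
  k∸δ≡d⇔ : (k ∸ δ ≡ d) ⇔ (δ ≡ k ∸ d)
  k∸δ≡d⇔ = mk⇔ (λ eq → trans (sym (m∸[m∸n]≡n (<⇒≤ δ<k))) (cong (k ∸_) eq))
               (λ eq → trans (cong (k ∸_) eq) (m∸[m∸n]≡n d≤k))
  δ≢d : δ ≢ d
  δ≢d refl = <⇒≱ 2d<k (≤-trans (≤-reflexive (sym (m∸n+n≡m d≤k))) (+-monoˡ-≤ δ (<⇒≤ k∸δ<δ)))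

𝟙[arcDist≡d]-≡ : ∀ {k δ d} → d + d ≡ k → δ < k → 𝟙 (arcDist k δ ≡ᵇ d) ≡ 𝟙 (δ ≡ᵇ d)
𝟙[arcDist≡d]-≡ {k} {δ} {d} 2d≡k δ<k with δ ≤? k ∸ δ
... | yes δ≤k∸δ = cong (λ x → 𝟙 (x ≡ᵇ d)) (m≤n⇒m⊓n≡m δ≤k∸δ)
... | no δ≰k∸δ = begin
  𝟙 (δ ⊓ (k ∸ δ) ≡ᵇ d)  ≡⟨ cong (λ x → 𝟙 (x ≡ᵇ d)) (m≥n⇒m⊓n≡n (<⇒≤ (≰⇒> δ≰k∸δ))) ⟩
  𝟙 (k ∸ δ ≡ᵇ d)        ≡⟨ cong 𝟙 (does-⇔ k∸δ≡d⇔ (k ∸ δ ≟ d) (δ ≟ d)) ⟩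
  𝟙 (δ ≡ᵇ d)            ∎
  where
  open ≡-Reasoning
  k∸d≡d : k ∸ d ≡ d
  k∸d≡d = trans (cong (_∸ d) (sym 2d≡k)) (m+n∸n≡m d d)
  k∸δ≡d⇔ : (k ∸ δ ≡ d) ⇔ (δ ≡ d)
  k∸δ≡d⇔ = mk⇔ (λ eq → trans (sym (m∸[m∸n]≡n (<⇒≤ δ<k))) (trans (cong (k ∸_) eq) k∸d≡d))
               (λ eq → trans (cong (k ∸_) eq) k∸d≡d)

c+e<d+e⇔d≰c : ∀ {c d} e → (c + e < d + e) ⇔ (¬ d ≤ c)
c+e<d+e⇔d≰c {c} {d} e = mk⇔ (λ lt → <⇒≱ (+-cancelʳ-< e c d lt)) (λ d≰c → +-monoˡ-< e (≰⇒> d≰c))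

cycleSphere : ℕ → ℕ → ℕ
cycleSphere k zero = 1
cycleSphere k (suc d) with suc d + suc d <? k | suc d + suc d ≟ k
... | yes _ | _     = 2
... | no _  | yes _ = 1
... | no _  | no _  = 0

∑-𝟙[cycDist≡0] : ∀ {k c} → c < k → ∑[ y < k ] 𝟙 (cycDist k c (toℕ y) ≡ᵇ 0) ≡ 1
∑-𝟙[cycDist≡0] {k} {c} c<k = begin
  ∑[ y < k ] 𝟙 (cycDist k c (toℕ y) ≡ᵇ 0)
    ≡⟨ sum-cong-≗ {k} (λ y → cong 𝟙 (does-⇔ (d≡0⇔ (toℕ<n y)) (cycDist k c (toℕ y) ≟ 0) (toℕ y ≟ c))) ⟩
  ∑[ y < k ] 𝟙 (toℕ y ≡ᵇ c) ≡⟨ ∑-𝟙[i≡t] k c ⟩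
  𝟙 (c <ᵇ k)                ≡⟨ 𝟙-yes (c <? k) c<k ⟩
  1                         ∎
  where
  open ≡-Reasoning
  d≡0⇔ : ∀ {y} → y < k → (cycDist k c y ≡ 0) ⇔ (y ≡ c)
  d≡0⇔ y<k = mk⇔ (λ eq → sym (cycDist≡0⇒≡ c<k y<k eq)) (λ { refl → cycDist-self k c })

∑-𝟙[cycDist≡d]-< : ∀ {k c d} → 1 ≤ d → d + d < k → c < k →
  ∑[ y < k ] 𝟙 (cycDist k c (toℕ y) ≡ᵇ d) ≡ 2
∑-𝟙[cycDist≡d]-< {k} {c} {d} 1≤d 2d<k c<k = begin
  ∑[ y < k ] 𝟙 (arcDist k ∣ c - toℕ y ∣ ≡ᵇ d)
    ≡⟨ sum-cong-≗ {k} (λ y → 𝟙[arcDist≡d]-< 2d<k (∣x-z∣<k c<k (toℕ<n y))) ⟩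
  ∑[ y < k ] (𝟙 (∣ c - toℕ y ∣ ≡ᵇ d) + 𝟙 (∣ c - toℕ y ∣ ≡ᵇ k ∸ d))
    ≡⟨ ∑-distrib-+ {k} (λ y → 𝟙 (∣ c - toℕ y ∣ ≡ᵇ d)) _ ⟩
  ∑[ y < k ] 𝟙 (∣ c - toℕ y ∣ ≡ᵇ d) + ∑[ y < k ] 𝟙 (∣ c - toℕ y ∣ ≡ᵇ k ∸ d)
    ≡⟨ cong₂ _+_ (∑-𝟙[∣c-y∣≡e] k 1≤d c<k) (∑-𝟙[∣c-y∣≡e] k (m<n⇒0<n∸m d<k) c<k) ⟩
  (𝟙 (c + d <ᵇ k) + 𝟙 (d ≤ᵇ c)) + (𝟙 (c + (k ∸ d) <ᵇ k) + 𝟙 (k ∸ d ≤ᵇ c))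
    ≡⟨ cong (𝟙 (c + d <ᵇ k) + 𝟙 (d ≤ᵇ c) +_) (+-comm (𝟙 (c + (k ∸ d) <ᵇ k)) _) ⟩
  (𝟙 (c + d <ᵇ k) + 𝟙 (d ≤ᵇ c)) + (𝟙 (k ∸ d ≤ᵇ c) + 𝟙 (c + (k ∸ d) <ᵇ k))
    ≡⟨ interchange (𝟙 (c + d <ᵇ k)) (𝟙 (d ≤ᵇ c)) (𝟙 (k ∸ d ≤ᵇ c)) (𝟙 (c + (k ∸ d) <ᵇ k)) ⟩
  (𝟙 (c + d <ᵇ k) + 𝟙 (k ∸ d ≤ᵇ c)) + (𝟙 (d ≤ᵇ c) + 𝟙 (c + (k ∸ d) <ᵇ k))
    ≡⟨ cong₂ _+_ (𝟙-complement (c + d <? k) (k ∸ d ≤? c) k∸d≤c⇔)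
                 (𝟙-complement (d ≤? c) (c + (k ∸ d) <? k) c+[k∸d]<k⇔) ⟩
  2 ∎
  where
  open ≡-Reasoning
  d<k : d < k
  d<k = <-≤-trans (m<m+n d 1≤d) (<⇒≤ 2d<k)
  k∸d≤c⇔ : (k ∸ d ≤ c) ⇔ (¬ c + d < k)
  k∸d≤c⇔ = mk⇔ (λ le → ≤⇒≯ (≤-trans (m≤n+m∸n k d) (≤-trans (+-monoʳ-≤ d le) (≤-reflexive (+-comm d c)))))
               (λ ≮ → m≤n+o⇒m∸n≤o k d (≤-trans (≮⇒≥ ≮) (≤-reflexive (+-comm c d))))
  c+[k∸d]<k⇔ : (c + (k ∸ d) < k) ⇔ (¬ d ≤ c)
  c+[k∸d]<k⇔ = subst (λ t → (c + (k ∸ d) < t) ⇔ (¬ d ≤ c)) (m+[n∸m]≡n (<⇒≤ d<k)) (c+e<d+e⇔d≰c (k ∸ d))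

∑-𝟙[cycDist≡d]-≡ : ∀ {k c d} → 1 ≤ d → d + d ≡ k → c < k →
  ∑[ y < k ] 𝟙 (cycDist k c (toℕ y) ≡ᵇ d) ≡ 1
∑-𝟙[cycDist≡d]-≡ {k} {c} {d} 1≤d 2d≡k c<k = begin
  ∑[ y < k ] 𝟙 (arcDist k ∣ c - toℕ y ∣ ≡ᵇ d)
    ≡⟨ sum-cong-≗ {k} (λ y → 𝟙[arcDist≡d]-≡ 2d≡k (∣x-z∣<k c<k (toℕ<n y))) ⟩
  ∑[ y < k ] 𝟙 (∣ c - toℕ y ∣ ≡ᵇ d)         ≡⟨ ∑-𝟙[∣c-y∣≡e] k 1≤d c<k ⟩
  𝟙 (c + d <ᵇ k) + 𝟙 (d ≤ᵇ c)               ≡⟨ +-comm (𝟙 (c + d <ᵇ k)) _ ⟩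
  𝟙 (d ≤ᵇ c) + 𝟙 (c + d <ᵇ k)               ≡⟨ 𝟙-complement (d ≤? c) (c + d <? k) c+d<k⇔ ⟩
  1                                         ∎
  where
  open ≡-Reasoning
  c+d<k⇔ : (c + d < k) ⇔ (¬ d ≤ c)
  c+d<k⇔ = subst (λ t → (c + d < t) ⇔ (¬ d ≤ c)) 2d≡k (c+e<d+e⇔d≰c d)

∑-𝟙[cycDist≡d]-> : ∀ {k c d} → k < d + d → c < k → ∑[ y < k ] 𝟙 (cycDist k c (toℕ y) ≡ᵇ d) ≡ 0
∑-𝟙[cycDist≡d]-> {k} {c} {d} k<2d c<k =
  trans (sum-cong-≗ {k} (λ y → 𝟙-no (cycDist k c (toℕ y) ≟ d) (cycDist≢d (toℕ<n y)))) (sum-replicate-zero k)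
  where
  cycDist≢d : ∀ {y} → y < k → cycDist k c y ≢ d
  cycDist≢d y<k refl = <⇒≱ k<2d (cycDist-half c<k y<k)

∑-𝟙[cycDist≡d] : ∀ {k c} d → c < k → ∑[ y < k ] 𝟙 (cycDist k c (toℕ y) ≡ᵇ d) ≡ cycleSphere k d
∑-𝟙[cycDist≡d] zero c<k = ∑-𝟙[cycDist≡0] c<k
∑-𝟙[cycDist≡d] {k} (suc d) c<k with suc d + suc d <? k | suc d + suc d ≟ k
... | yes 2d<k  | _        = ∑-𝟙[cycDist≡d]-< z<s 2d<k c<k
... | no _      | yes 2d≡k = ∑-𝟙[cycDist≡d]-≡ z<s 2d≡k c<k
... | no 2d≮k   | no 2d≢k  = ∑-𝟙[cycDist≡d]-> (≤∧≢⇒< (≮⇒≥ 2d≮k) (2d≢k ∘ sym)) c<k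

cycleSphere-interior : ∀ {k} d → suc d + suc d < k → cycleSphere k (suc d) ≡ 2
cycleSphere-interior {k} d 2d<k with suc d + suc d <? k
... | yes _   = refl
... | no 2d≮k = contradiction 2d<k 2d≮k

∑-cycDist≤2 : ∀ {k c} (f : ℕ → ℕ) → (∀ d → f (3 + d) ≡ 0) → c < k →
  ∑[ j < k ] f (cycDist k (toℕ j) c) ≡ f 0 * cycleSphere k 0 + f 1 * cycleSphere k 1 + f 2 * cycleSphere k 2
∑-cycDist≤2 {k} {c} f f≡0 c<k = begin
  ∑[ j < k ] f (cycDist k (toℕ j) c)
    ≡⟨ sum-cong-≗ {k} (λ j → cong f (cycDist-comm k (toℕ j) c)) ⟩
  ∑[ j < k ] f (cycDist k c (toℕ j))
    ≡⟨ sum-cong-≗ {k} (λ j → decompose (cycDist k c (toℕ j))) ⟩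
  ∑[ j < k ] (f 0 * 𝟙[ j ≡ 0 ] + f 1 * 𝟙[ j ≡ 1 ] + f 2 * 𝟙[ j ≡ 2 ])
    ≡⟨ ∑-distrib-+₃ k (λ j → f 0 * 𝟙[ j ≡ 0 ]) (λ j → f 1 * 𝟙[ j ≡ 1 ]) (λ j → f 2 * 𝟙[ j ≡ 2 ]) ⟩
  ∑[ j < k ] (f 0 * 𝟙[ j ≡ 0 ]) + ∑[ j < k ] (f 1 * 𝟙[ j ≡ 1 ]) + ∑[ j < k ] (f 2 * 𝟙[ j ≡ 2 ])
    ≡⟨ cong₂ _+_ (cong₂ _+_ (scaled 0) (scaled 1)) (scaled 2) ⟩
  f 0 * cycleSphere k 0 + f 1 * cycleSphere k 1 + f 2 * cycleSphere k 2 ∎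
  where
  open ≡-Reasoning
  𝟙[_≡_] : Fin k → ℕ → ℕ
  𝟙[ j ≡ d ] = 𝟙 (cycDist k c (toℕ j) ≡ᵇ d)
  scaled : ∀ d → ∑[ j < k ] (f d * 𝟙[ j ≡ d ]) ≡ f d * cycleSphere k d
  scaled d = trans (sym (*-distribˡ-sum (f d) (λ j → 𝟙[ j ≡ d ]))) (cong (f d *_) (∑-𝟙[cycDist≡d] d c<k))
  decompose : ∀ d → f d ≡ f 0 * 𝟙 (d ≡ᵇ 0) + f 1 * 𝟙 (d ≡ᵇ 1) + f 2 * 𝟙 (d ≡ᵇ 2)
  decompose 0 = at-0 (f 0) (f 1) (f 2)
    where at-0 : ∀ x y z → x ≡ x * 1 + y * 0 + z * 0
          at-0 = solve-∀
  decompose 1 = at-1 (f 0) (f 1) (f 2)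
    where at-1 : ∀ x y z → y ≡ x * 0 + y * 1 + z * 0
          at-1 = solve-∀
  decompose 2 = at-2 (f 0) (f 1) (f 2)
    where at-2 : ∀ x y z → z ≡ x * 0 + y * 0 + z * 1
          at-2 = solve-∀
  decompose (suc (suc (suc d))) = trans (f≡0 d) (elsewhere (f 0) (f 1) (f 2))
    where elsewhere : ∀ x y z → 0 ≡ x * 0 + y * 0 + z * 0
          elsewhere = solve-∀

-- The meta-chain

cap₄ : ℕ → ℕ
cap₄ 0 = 0
cap₄ 1 = 1
cap₄ 2 = 2
cap₄ 3 = 3
cap₄ (suc (suc (suc (suc _)))) = 4

cap₄≡⊓4 : ∀ x → cap₄ x ≡ x ⊓ 4
cap₄≡⊓4 0 = refl
cap₄≡⊓4 1 = refl
cap₄≡⊓4 2 = refl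
cap₄≡⊓4 3 = refl
cap₄≡⊓4 (suc (suc (suc (suc x)))) = cong (λ t → suc (suc (suc (suc t)))) (sym (⊓-zeroʳ x))

cap₄≤4 : ∀ x → cap₄ x ≤ 4
cap₄≤4 x = subst (_≤ 4) (sym (cap₄≡⊓4 x)) (m⊓n≤n x 4)

cap₄-lipschitz : ∀ {x y} → x ≤ suc y → cap₄ x ≤ suc (cap₄ y)
cap₄-lipschitz {x} {y} x≤ =
  ≤-trans (subst₂ _≤_ (sym (cap₄≡⊓4 x)) (sym (cap₄≡⊓4 (suc y))) (⊓-monoˡ-≤ 4 x≤)) (cap₄-suc-≤ y)
  where
  cap₄-suc-≤ : ∀ y → cap₄ (suc y) ≤ suc (cap₄ y)
  cap₄-suc-≤ 0 = s≤s z≤n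
  cap₄-suc-≤ 1 = ≤-refl
  cap₄-suc-≤ 2 = ≤-refl
  cap₄-suc-≤ 3 = ≤-refl
  cap₄-suc-≤ (suc (suc (suc (suc _)))) = n≤1+n 4

cap₄-suc : ∀ {x y} → suc y ≡ x → cap₄ x ≤ 3 → suc (cap₄ y) ≡ cap₄ x
cap₄-suc {y = 0} refl _ = refl
cap₄-suc {y = 1} refl _ = refl
cap₄-suc {y = 2} refl _ = refl
cap₄-suc {y = suc (suc (suc _))} refl (s≤s (s≤s (s≤s ())))

0<cap₄⇒0< : ∀ {x} → 0 < cap₄ x → 0 < x
0<cap₄⇒0< {suc _} _ = z<s

cap₄≡0⇒≡0 : ∀ {x} → cap₄ x ≡ 0 → x ≡ 0
cap₄≡0⇒≡0 {0} _ = refl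
cap₄≡0⇒≡0 {1} ()
cap₄≡0⇒≡0 {2} ()
cap₄≡0⇒≡0 {3} ()
cap₄≡0⇒≡0 {suc (suc (suc (suc _)))} ()

3≤cap₄ : ∀ {x} → 3 ≤ x → 3 ≤ cap₄ x
3≤cap₄ {1} (s≤s ())
3≤cap₄ {2} (s≤s (s≤s ()))
3≤cap₄ {3} _ = ≤-refl
3≤cap₄ {suc (suc (suc (suc _)))} _ = n≤1+n 3

cap₄≡ᵇ3 : ∀ x → (cap₄ x ≡ᵇ 3) ≡ (x ≡ᵇ 3)
cap₄≡ᵇ3 0 = refl
cap₄≡ᵇ3 1 = refl
cap₄≡ᵇ3 2 = refl
cap₄≡ᵇ3 3 = refl
cap₄≡ᵇ3 (suc (suc (suc (suc _)))) = refl

crossings : ℕ → ℕ → ℕ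
crossings k 0 = cycleSphere k 2
crossings k 1 = cycleSphere k 1
crossings k 2 = cycleSphere k 0
crossings k (suc (suc (suc _))) = 0

∑-crossings : ∀ {k c} x → c < k → ∑[ y < k ] 𝟙 (cap₄ (suc (x + cycDist k c (toℕ y))) ≡ᵇ 3) ≡ crossings k x
∑-crossings {k} {c} x c<k = trans (sum-cong-≗ {k} (λ y → cong 𝟙 (cap₄≡ᵇ3 (suc (x + cycDist k c (toℕ y)))))) (count x)
  where
  count : ∀ x → ∑[ y < k ] 𝟙 (suc (x + cycDist k c (toℕ y)) ≡ᵇ 3) ≡ crossings k x
  count 0                   = ∑-𝟙[cycDist≡d] 2 c<k
  count 1                   = ∑-𝟙[cycDist≡d] 1 c<k
  count 2                   = ∑-𝟙[cycDist≡d] 0 c<k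
  count (suc (suc (suc _))) = sum-replicate-zero k

acrossBridge : ℕ → ℕ
acrossBridge k = crossings k 0 * cycleSphere k 0 + crossings k 1 * cycleSphere k 1 + crossings k 2 * cycleSphere k 2

data Offset (m n : ℕ) : Set where
  same : m ≡ n → Offset m n
  next : suc m ≡ n → Offset m n
  prev : suc n ≡ m → Offset m n
  far  : m ≢ n → suc m ≢ n → suc n ≢ m → Offset m n

offset : ∀ m n → Offset m n
offset m n with m ≟ n | suc m ≟ n | suc n ≟ m
... | yes m≡n | _       | _       = same m≡n
... | no _    | yes m+1≡n | _     = next m+1≡n
... | no _    | no _    | yes n+1≡m = prev n+1≡m
... | no m≢n  | no m+1≢n | no n+1≢m = far m≢n m+1≢n n+1≢m

module MetaChain (k h : ℕ) (a b : Fin h → Fin k) where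

  Vertex : Set
  Vertex = Fin h × Fin k

  entry exit : Fin h → ℕ
  entry i = toℕ (a i)
  exit  i = toℕ (b i)

  gonAdj bridge chainAdj : Vertex → Vertex → Bool
  gonAdj (i , j) (i′ , j′) = (toℕ i ≡ᵇ toℕ i′) ∧ cycAdj k (toℕ j) (toℕ j′)
  bridge (i , j) (i′ , j′) = (suc (toℕ i) ≡ᵇ toℕ i′) ∧ (toℕ j ≡ᵇ exit i) ∧ (toℕ j′ ≡ᵇ entry i′)
  chainAdj p q = gonAdj p q ∨ bridge p q ∨ bridge q p

  metaChainAdj≡chainAdj : ∀ u v → metaChainAdj k h a b u v ≡ chainAdj (remQuot k u) (remQuot k v)
  metaChainAdj≡chainAdj u v with remQuot {h} k u | remQuot {h} k v
  ... | _ | _ = refl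

  data Edge : Vertex → Vertex → Set where
    cycle   : ∀ {i j j′} → T (cycAdj k (toℕ j) (toℕ j′)) → Edge (i , j) (i , j′)
    bridge⁺ : ∀ {i i′ j j′} → suc (toℕ i) ≡ toℕ i′ → toℕ j ≡ exit i → toℕ j′ ≡ entry i′ →
              Edge (i , j) (i′ , j′)
    bridge⁻ : ∀ {i i′ j j′} → suc (toℕ i′) ≡ toℕ i → toℕ j′ ≡ exit i′ → toℕ j ≡ entry i →
              Edge (i , j) (i′ , j′)

  T-bridge⇔ : ∀ {i i′ j j′} →
              T (bridge (i , j) (i′ , j′)) ⇔ (suc (toℕ i) ≡ toℕ i′ × toℕ j ≡ exit i × toℕ j′ ≡ entry i′)
  T-bridge⇔ {i} {i′} {j} = mk⇔
    (λ t → let (e₁ , t′) = Equivalence.to (T-∧ {suc (toℕ i) ≡ᵇ toℕ i′}) t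
               (e₂ , e₃) = Equivalence.to (T-∧ {toℕ j ≡ᵇ exit i}) t′
           in ≡ᵇ⇒≡ _ _ e₁ , ≡ᵇ⇒≡ _ _ e₂ , ≡ᵇ⇒≡ _ _ e₃)
    (λ (e₁ , e₂ , e₃) →
       Equivalence.from T-∧ (≡⇒≡ᵇ _ _ e₁ , Equivalence.from T-∧ (≡⇒≡ᵇ _ _ e₂ , ≡⇒≡ᵇ _ _ e₃)))

  chainAdj⇒Edge : ∀ {p q} → T (chainAdj p q) → Edge p q
  chainAdj⇒Edge {i , j} {i′ , j′} adj with Equivalence.to (T-∨ {gonAdj (i , j) (i′ , j′)}) adj
  ... | inj₁ g with Equivalence.to (T-∧ {toℕ i ≡ᵇ toℕ i′}) g
  ...   | e , cyc with toℕ-injective {i = i} {i′} (≡ᵇ⇒≡ _ _ e)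
  ...     | refl = cycle cyc
  chainAdj⇒Edge {i , j} {i′ , j′} adj | inj₂ br with Equivalence.to (T-∨ {bridge (i , j) (i′ , j′)}) br
  ... | inj₁ b⁺ = let (e₁ , e₂ , e₃) = Equivalence.to T-bridge⇔ b⁺ in bridge⁺ e₁ e₂ e₃
  ... | inj₂ b⁻ = let (e₁ , e₂ , e₃) = Equivalence.to T-bridge⇔ b⁻ in bridge⁻ e₁ e₂ e₃

  Edge⇒chainAdj : ∀ {p q} → Edge p q → T (chainAdj p q)
  Edge⇒chainAdj {i , _} (cycle cyc) = T-∨ˡ _ (Equivalence.from T-∧ (≡⇒≡ᵇ (toℕ i) (toℕ i) refl , cyc))
  Edge⇒chainAdj {p} {q} (bridge⁺ e₁ e₂ e₃) =
    T-∨ʳ (gonAdj p q) (T-∨ˡ _ (Equivalence.from T-bridge⇔ (e₁ , e₂ , e₃)))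
  Edge⇒chainAdj {p} {q} (bridge⁻ e₁ e₂ e₃) =
    T-∨ʳ (gonAdj p q) (T-∨ʳ (bridge p q) (Equivalence.from T-bridge⇔ (e₁ , e₂ , e₃)))

  -- The graph distance, truncated at 4.
  chainDist : Vertex → Vertex → ℕ
  chainDist (i , j) (i′ , j′) =
    if toℕ i ≡ᵇ toℕ i′ then cap₄ (cycDist k (toℕ j) (toℕ j′))
    else if suc (toℕ i) ≡ᵇ toℕ i′ then cap₄ (suc (cycDist k (toℕ j) (exit i) + cycDist k (entry i′) (toℕ j′)))
    else if suc (toℕ i′) ≡ᵇ toℕ i then cap₄ (suc (cycDist k (toℕ j) (entry i) + cycDist k (exit i′) (toℕ j′)))
    else 4

  module _ (i i′ : Fin h) (j j′ : Fin k) where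

    chainDist-same : toℕ i ≡ toℕ i′ → chainDist (i , j) (i′ , j′) ≡ cap₄ (cycDist k (toℕ j) (toℕ j′))
    chainDist-same e rewrite dec-true (toℕ i ≟ toℕ i′) e = refl

    chainDist-next : suc (toℕ i) ≡ toℕ i′ →
      chainDist (i , j) (i′ , j′) ≡ cap₄ (suc (cycDist k (toℕ j) (exit i) + cycDist k (entry i′) (toℕ j′)))
    chainDist-next e
      rewrite dec-false (toℕ i ≟ toℕ i′) (λ e′ → 1+n≢n (trans e (sym e′)))
            | dec-true (suc (toℕ i) ≟ toℕ i′) e = refl

    chainDist-prev : suc (toℕ i′) ≡ toℕ i →
      chainDist (i , j) (i′ , j′) ≡ cap₄ (suc (cycDist k (toℕ j) (entry i) + cycDist k (exit i′) (toℕ j′)))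
    chainDist-prev e
      rewrite dec-false (toℕ i ≟ toℕ i′) (λ e′ → 1+n≢n (trans e e′))
            | dec-false (suc (toℕ i) ≟ toℕ i′) (λ e′ → >⇒≢ (n≤1+n (suc (toℕ i))) (trans (cong suc e′) e))
            | dec-true (suc (toℕ i′) ≟ toℕ i) e = refl

    chainDist-far : toℕ i ≢ toℕ i′ → suc (toℕ i) ≢ toℕ i′ → suc (toℕ i′) ≢ toℕ i →
                    chainDist (i , j) (i′ , j′) ≡ 4
    chainDist-far e₀ e₁ e₂
      rewrite dec-false (toℕ i ≟ toℕ i′) e₀
            | dec-false (suc (toℕ i) ≟ toℕ i′) e₁
            | dec-false (suc (toℕ i′) ≟ toℕ i) e₂ = refl

  chainDist≤4 : ∀ p q → chainDist p q ≤ 4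
  chainDist≤4 (i , j) (i′ , j′) with offset (toℕ i) (toℕ i′)
  ... | same e      rewrite chainDist-same i i′ j j′ e      = cap₄≤4 _
  ... | next e      rewrite chainDist-next i i′ j j′ e      = cap₄≤4 _
  ... | prev e      rewrite chainDist-prev i i′ j j′ e      = cap₄≤4 _
  ... | far e₀ e₁ e₂ rewrite chainDist-far i i′ j j′ e₀ e₁ e₂ = ≤-refl

  chainDist-self : ∀ p → chainDist p p ≡ 0
  chainDist-self (i , j) = trans (chainDist-same i i j j refl) (cong cap₄ (cycDist-self k (toℕ j)))

  chainDist≡0⇒≡ : ∀ {p q} → chainDist p q ≡ 0 → p ≡ q
  chainDist≡0⇒≡ {i , j} {i′ , j′} d≡0 with offset (toℕ i) (toℕ i′)
  ... | same e = cong₂ _,_ (toℕ-injective e)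
          (toℕ-injective (cycDist≡0⇒≡ (toℕ<n j) (toℕ<n j′)
            (cap₄≡0⇒≡0 (trans (sym (chainDist-same i i′ j j′ e)) d≡0))))
  ... | next e = contradiction (cap₄≡0⇒≡0 (trans (sym (chainDist-next i i′ j j′ e)) d≡0)) λ ()
  ... | prev e = contradiction (cap₄≡0⇒≡0 (trans (sym (chainDist-prev i i′ j j′ e)) d≡0)) λ ()
  ... | far e₀ e₁ e₂ = contradiction (trans (sym (chainDist-far i i′ j j′ e₀ e₁ e₂)) d≡0) λ ()

  through-bridge-comm : ∀ x c c′ y → cycDist k x c + cycDist k c′ y ≡ cycDist k y c′ + cycDist k c x
  through-bridge-comm x c c′ y = trans (+-comm (cycDist k x c) _) (cong₂ _+_ (cycDist-comm k c′ y) (cycDist-comm k x c))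

  chainDist-comm : ∀ p q → chainDist p q ≡ chainDist q p
  chainDist-comm (i , j) (i′ , j′) with offset (toℕ i) (toℕ i′)
  ... | same e = begin
    chainDist (i , j) (i′ , j′)          ≡⟨ chainDist-same i i′ j j′ e ⟩
    cap₄ (cycDist k (toℕ j) (toℕ j′))    ≡⟨ cong cap₄ (cycDist-comm k (toℕ j) (toℕ j′)) ⟩
    cap₄ (cycDist k (toℕ j′) (toℕ j))    ≡⟨ chainDist-same i′ i j′ j (sym e) ⟨
    chainDist (i′ , j′) (i , j)          ∎
    where open ≡-Reasoning
  ... | next e = trans (chainDist-next i i′ j j′ e)
    (trans (cong (cap₄ ∘ suc) (through-bridge-comm (toℕ j) (exit i) (entry i′) (toℕ j′)))
           (sym (chainDist-prev i′ i j′ j e)))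
  ... | prev e = trans (chainDist-prev i i′ j j′ e)
    (trans (cong (cap₄ ∘ suc) (through-bridge-comm (toℕ j) (entry i) (exit i′) (toℕ j′)))
           (sym (chainDist-next i′ i j′ j e)))
  ... | far e₀ e₁ e₂ =
    trans (chainDist-far i i′ j j′ e₀ e₁ e₂) (sym (chainDist-far i′ i j′ j (e₀ ∘ sym) e₂ e₁))

  chainDist-two-apart : ∀ i i′ j j′ → suc (suc (toℕ i′)) ≡ toℕ i ⊎ suc (suc (toℕ i)) ≡ toℕ i′ →
                        chainDist (i , j) (i′ , j′) ≡ 4
  chainDist-two-apart i i′ j j′ (inj₁ e) = chainDist-far i i′ j j′
    (λ e′ → >⇒≢ (n≤1+n (suc (toℕ i′))) (trans e e′))
    (λ e′ → >⇒≢ (≤-trans (n≤1+n _) (n≤1+n _)) (trans (cong suc e) e′))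
    (λ e′ → 1+n≢n (trans e (sym e′)))
  chainDist-two-apart i i′ j j′ (inj₂ e) = chainDist-far i i′ j j′
    (λ e′ → >⇒≢ (n≤1+n (suc (toℕ i))) (trans e (sym e′))) (λ e′ → 1+n≢n (trans e (sym e′)))
    (λ e′ → >⇒≢ (≤-trans (n≤1+n _) (n≤1+n _)) (trans (cong suc e) e′))

  chainDist-edge-from-3 : ∀ p w q → 3 ≤ chainDist w q → chainDist p q ≤ suc (chainDist w q)
  chainDist-edge-from-3 p w q 3≤ = ≤-trans (chainDist≤4 p q) (s≤s 3≤)

  chainDist-edge-cycle : ∀ {i j jw} q → T (cycAdj k (toℕ j) (toℕ jw)) → chainDist (i , j) q ≤ suc (chainDist (i , jw) q)
  chainDist-edge-cycle {i} {j} {jw} (i′ , j′) adj with offset (toℕ i) (toℕ i′)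
  ... | same e rewrite chainDist-same i i′ j j′ e | chainDist-same i i′ jw j′ e =
        cap₄-lipschitz (cycDist-edge {x = toℕ j} {toℕ jw} (toℕ<n j′) adj)
  ... | next e rewrite chainDist-next i i′ j j′ e | chainDist-next i i′ jw j′ e =
        cap₄-lipschitz (s≤s (+-monoˡ-≤ _ (cycDist-edge {x = toℕ j} {toℕ jw} (toℕ<n (b i)) adj)))
  ... | prev e rewrite chainDist-prev i i′ j j′ e | chainDist-prev i i′ jw j′ e =
        cap₄-lipschitz (s≤s (+-monoˡ-≤ _ (cycDist-edge {x = toℕ j} {toℕ jw} (toℕ<n (a i)) adj)))
  ... | far e₀ e₁ e₂ rewrite chainDist-far i i′ j j′ e₀ e₁ e₂ | chainDist-far i i′ jw j′ e₀ e₁ e₂ = n≤1+n 4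

  Descent : Vertex → Vertex → Set
  Descent p q = ∃[ w ] Edge p w × suc (chainDist w q) ≡ chainDist p q

  descent-in-gon : ∀ {i j} q c (F : ℕ → ℕ) → c < k → (∀ d → F (suc d) ≡ suc (F d)) →
                   (∀ j → chainDist (i , j) q ≡ cap₄ (F (cycDist k (toℕ j) c))) →
                   0 < cycDist k (toℕ j) c → chainDist (i , j) q ≤ 3 → Descent (i , j) q
  descent-in-gon {i} {j} q c F c<k F-suc shape d>0 ≤3 with cycDist-descent (toℕ<n j) c<k d>0
  ... | y , y<k , adj , eq = (i , fromℕ< y<k) , cycle (subst (T ∘ cycAdj k (toℕ j)) (sym y≡) adj) , (begin
    suc (chainDist (i , fromℕ< y<k) q)             ≡⟨ cong suc (shape (fromℕ< y<k)) ⟩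
    suc (cap₄ (F (cycDist k (toℕ (fromℕ< y<k)) c))) ≡⟨ cong (λ t → suc (cap₄ (F (cycDist k t c)))) y≡ ⟩
    suc (cap₄ (F (cycDist k y c)))
      ≡⟨ cap₄-suc (trans (sym (F-suc _)) (cong F eq)) (subst (_≤ 3) (shape j) ≤3) ⟩
    cap₄ (F (cycDist k (toℕ j) c))                 ≡⟨ shape j ⟨
    chainDist (i , j) q                            ∎)
    where
    open ≡-Reasoning
    y≡ = toℕ-fromℕ< y<k

  descent-across⁺ : ∀ {i i′ j} j′ → suc (toℕ i) ≡ toℕ i′ → toℕ j ≡ exit i →
                    chainDist (i , j) (i′ , j′) ≤ 3 → Descent (i , j) (i′ , j′)
  descent-across⁺ {i} {i′} {j} j′ e ej ≤3 = (i′ , a i′) , bridge⁺ e ej refl , step ≤3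
    where
    step : chainDist (i , j) (i′ , j′) ≤ 3 → suc (chainDist (i′ , a i′) (i′ , j′)) ≡ chainDist (i , j) (i′ , j′)
    step le rewrite chainDist-same i′ i′ (a i′) j′ refl | chainDist-next i i′ j j′ e | ej | cycDist-self k (exit i) =
      cap₄-suc refl le

  descent-across⁻ : ∀ {i i′ j} j′ → suc (toℕ i′) ≡ toℕ i → toℕ j ≡ entry i →
                    chainDist (i , j) (i′ , j′) ≤ 3 → Descent (i , j) (i′ , j′)
  descent-across⁻ {i} {i′} {j} j′ e ej ≤3 = (i′ , b i′) , bridge⁻ e refl ej , step ≤3
    where
    step : chainDist (i , j) (i′ , j′) ≤ 3 → suc (chainDist (i′ , b i′) (i′ , j′)) ≡ chainDist (i , j) (i′ , j′)
    step le rewrite chainDist-same i′ i′ (b i′) j′ refl | chainDist-prev i i′ j j′ e | ej | cycDist-self k (entry i) =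
      cap₄-suc refl le

  chainDist-descent : ∀ {p q} → 0 < chainDist p q → chainDist p q ≤ 3 → Descent p q
  chainDist-descent {i , j} {i′ , j′} d>0 ≤3 with offset (toℕ i) (toℕ i′)
  ... | same e = descent-in-gon (i′ , j′) (toℕ j′) (λ d → d) (toℕ<n j′) (λ _ → refl)
                   (λ j → chainDist-same i i′ j j′ e) (0<cap₄⇒0< (subst (0 <_) (chainDist-same i i′ j j′ e) d>0)) ≤3
  ... | next e with cycDist k (toℕ j) (exit i) ≟ 0
  ...   | yes X≡0 = descent-across⁺ j′ e (cycDist≡0⇒≡ (toℕ<n j) (toℕ<n (b i)) X≡0) ≤3
  ...   | no X≢0 = descent-in-gon (i′ , j′) (exit i) (λ d → suc (d + cycDist k (entry i′) (toℕ j′))) (toℕ<n (b i))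
                     (λ _ → refl) (λ j → chainDist-next i i′ j j′ e) (n≢0⇒n>0 X≢0) ≤3
  chainDist-descent {i , j} {i′ , j′} d>0 ≤3 | prev e with cycDist k (toℕ j) (entry i) ≟ 0
  ...   | yes Y≡0 = descent-across⁻ j′ e (cycDist≡0⇒≡ (toℕ<n j) (toℕ<n (a i)) Y≡0) ≤3
  ...   | no Y≢0 = descent-in-gon (i′ , j′) (entry i) (λ d → suc (d + cycDist k (exit i′) (toℕ j′))) (toℕ<n (a i))
                     (λ _ → refl) (λ j → chainDist-prev i i′ j j′ e) (n≢0⇒n>0 Y≢0) ≤3
  chainDist-descent {i , j} {i′ , j′} d>0 ≤3 | far e₀ e₁ e₂ =
    contradiction (subst (_≤ 3) (chainDist-far i i′ j j′ e₀ e₁ e₂) ≤3) (<⇒≱ ≤-refl)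

  module _ (t2 : TypeTwo k h a b) where

    3≤chainDist-from-entry : ∀ {i i′} j j′ → suc (toℕ i) ≡ toℕ i′ → 0 < toℕ i → toℕ j ≡ entry i →
                          3 ≤ chainDist (i , j) (i′ , j′)
    3≤chainDist-from-entry {i} {i′} j j′ e 0<i ej rewrite chainDist-next i i′ j j′ e | ej =
      3≤cap₄ (s≤s (≤-trans (t2 i 0<i (subst (_< h) (sym e) (toℕ<n i′))) (m≤m+n _ _)))

    3≤chainDist-from-exit : ∀ {i i′} j j′ → suc (toℕ i′) ≡ toℕ i → suc (toℕ i) < h → toℕ j ≡ exit i →
                          3 ≤ chainDist (i , j) (i′ , j′)
    3≤chainDist-from-exit {i} {i′} j j′ e i+1<h ej rewrite chainDist-prev i i′ j j′ e | ej =
      3≤cap₄ (s≤s (≤-trans (subst (2 ≤_) (cycDist-comm k (entry i) (exit i)) (t2 i (subst (0 <_) e z<s) i+1<h))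
                           (m≤m+n _ _)))

    chainDist-edge-bridge⁺ : ∀ {i iw j jw} q → suc (toℕ i) ≡ toℕ iw → toℕ j ≡ exit i → toℕ jw ≡ entry iw →
                                  chainDist (i , j) q ≤ suc (chainDist (iw , jw) q)
    chainDist-edge-bridge⁺ {i} {iw} {j} {jw} (i′ , j′) f ej ejw with offset (toℕ i) (toℕ i′)
    ... | same e with toℕ-injective {i = i} {i′} e
    ...   | refl rewrite chainDist-same i i j j′ refl | chainDist-prev iw i jw j′ f | ej | ejw | cycDist-self k (entry iw) =
            cap₄-lipschitz (m≤n⇒m≤1+n (n≤1+n _))
    chainDist-edge-bridge⁺ {i} {iw} {j} {jw} (i′ , j′) f ej ejw | next e with toℕ-injective {i = iw} {i′} (trans (sym f) e)
    ... | refl rewrite chainDist-next i iw j j′ f | chainDist-same iw iw jw j′ refl | ej | ejw | cycDist-self k (exit i) =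
            cap₄-lipschitz ≤-refl
    chainDist-edge-bridge⁺ {i} {iw} {j} {jw} (i′ , j′) f ej ejw | prev e =
      chainDist-edge-from-3 (i , j) (iw , jw) (i′ , j′)
        (≤-trans (n≤1+n 3) (≤-reflexive (sym (chainDist-two-apart iw i′ jw j′ (inj₁ (trans (cong suc e) f))))))
    chainDist-edge-bridge⁺ {i} {iw} {j} {jw} (i′ , j′) f ej ejw | far e₀ e₁ e₂ with offset (toℕ iw) (toℕ i′)
    ... | same e′ = contradiction (trans f e′) e₁
    ... | prev e′ = contradiction (suc-injective (trans f (sym e′))) e₀
    ... | next e′ = chainDist-edge-from-3 (i , j) (iw , jw) (i′ , j′)
            (3≤chainDist-from-entry jw j′ e′ (subst (0 <_) f z<s) ejw)
    ... | far e₀′ e₁′ e₂′ = chainDist-edge-from-3 (i , j) (iw , jw) (i′ , j′)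
            (≤-trans (n≤1+n 3) (≤-reflexive (sym (chainDist-far iw i′ jw j′ e₀′ e₁′ e₂′))))

    chainDist-edge-bridge⁻ : ∀ {i iw j jw} q → suc (toℕ iw) ≡ toℕ i → toℕ jw ≡ exit iw → toℕ j ≡ entry i →
                                  chainDist (i , j) q ≤ suc (chainDist (iw , jw) q)
    chainDist-edge-bridge⁻ {i} {iw} {j} {jw} (i′ , j′) g ejw ej with offset (toℕ i) (toℕ i′)
    ... | same e with toℕ-injective {i = i} {i′} e
    ...   | refl rewrite chainDist-same i i j j′ refl | chainDist-next iw i jw j′ g | ej | ejw | cycDist-self k (exit iw) =
            cap₄-lipschitz (m≤n⇒m≤1+n (n≤1+n _))
    chainDist-edge-bridge⁻ {i} {iw} {j} {jw} (i′ , j′) g ejw ej | prev e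
      with toℕ-injective {i = iw} {i′} (suc-injective (trans g (sym e)))
    ... | refl rewrite chainDist-prev i iw j j′ g | chainDist-same iw iw jw j′ refl | ej | ejw | cycDist-self k (entry i) =
            cap₄-lipschitz ≤-refl
    chainDist-edge-bridge⁻ {i} {iw} {j} {jw} (i′ , j′) g ejw ej | next e =
      chainDist-edge-from-3 (i , j) (iw , jw) (i′ , j′)
        (≤-trans (n≤1+n 3) (≤-reflexive (sym (chainDist-two-apart iw i′ jw j′ (inj₂ (trans (cong suc g) e))))))
    chainDist-edge-bridge⁻ {i} {iw} {j} {jw} (i′ , j′) g ejw ej | far e₀ e₁ e₂ with offset (toℕ iw) (toℕ i′)
    ... | same e′ = contradiction (trans (cong suc (sym e′)) g) e₂
    ... | next e′ = contradiction (trans (sym g) e′) e₀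
    ... | prev e′ = chainDist-edge-from-3 (i , j) (iw , jw) (i′ , j′)
            (3≤chainDist-from-exit jw j′ e′ (subst (_< h) (sym g) (toℕ<n i)) ejw)
    ... | far e₀′ e₁′ e₂′ = chainDist-edge-from-3 (i , j) (iw , jw) (i′ , j′)
            (≤-trans (n≤1+n 3) (≤-reflexive (sym (chainDist-far iw i′ jw j′ e₀′ e₁′ e₂′))))

    chainDist-edge : ∀ {p w} q → Edge p w → chainDist p q ≤ suc (chainDist w q)
    chainDist-edge {i , j}  {_ , jw}  q (cycle adj)        = chainDist-edge-cycle {i} {j} {jw} q adj
    chainDist-edge {i , j}  {iw , jw} q (bridge⁺ f ej ejw) = chainDist-edge-bridge⁺ {i} {iw} {j} {jw} q f ej ejw
    chainDist-edge {i , j}  {iw , jw} q (bridge⁻ g ejw ej) = chainDist-edge-bridge⁻ {i} {iw} {j} {jw} q g ejw ej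

    private
      adj : Adjacency (h * k)
      adj = metaChainAdj k h a b

      D : Fin (h * k) → Fin (h * k) → ℕ
      D u v = chainDist (remQuot k u) (remQuot k v)

      adj⇒Edge : ∀ {u w} → T (adj u w) → Edge (remQuot k u) (remQuot k w)
      adj⇒Edge {u} {w} uw = chainAdj⇒Edge (subst T (metaChainAdj≡chainAdj u w) uw)

      D-descent : ∀ {u v} → 0 < D u v → D u v ≤ 3 → ∃[ w ] T (adj u w) × suc (D w v) ≡ D u v
      D-descent {u} {v} d>0 ≤3 with chainDist-descent d>0 ≤3
      ... | (i , j) , edge , eq = combine i j ,
        subst T (sym (metaChainAdj≡chainAdj u (combine i j))) (Edge⇒chainAdj (subst (Edge (remQuot k u)) (sym rq≡) edge)) ,
        trans (cong (λ w → suc (chainDist w (remQuot k v))) rq≡) eq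
        where rq≡ = remQuot-combine i j

    open ReachViaDistance adj D 3 (remQuot-injective h k ∘ chainDist≡0⇒≡) (chainDist-self ∘ remQuot k)
                  (λ v uw → chainDist-edge (remQuot k v) (adj⇒Edge uw)) D-descent

    dist3≡chainDist≡3 : ∀ u v → dist3 adj u v ≡ (chainDist (remQuot k u) (remQuot k v) ≡ᵇ 3)
    dist3≡chainDist≡3 u v rewrite reach≤≡ ≤-refl u v | reach≤≡ (n≤1+n 2) u v = [d≤3]∧¬[d≤2] (D u v)

  ∑-same-gon : ∀ {i i′} j → toℕ i ≡ toℕ i′ →
               ∑[ j′ < k ] 𝟙 (chainDist (i , j) (i′ , j′) ≡ᵇ 3) ≡ cycleSphere k 3
  ∑-same-gon {i} {i′} j e = begin
    ∑[ j′ < k ] 𝟙 (chainDist (i , j) (i′ , j′) ≡ᵇ 3)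
      ≡⟨ sum-cong-≗ {k} (λ j′ → cong (λ d → 𝟙 (d ≡ᵇ 3)) (chainDist-same i i′ j j′ e)) ⟩
    ∑[ j′ < k ] 𝟙 (cap₄ (cycDist k (toℕ j) (toℕ j′)) ≡ᵇ 3)
      ≡⟨ sum-cong-≗ {k} (λ j′ → cong 𝟙 (cap₄≡ᵇ3 (cycDist k (toℕ j) (toℕ j′)))) ⟩
    ∑[ j′ < k ] 𝟙 (cycDist k (toℕ j) (toℕ j′) ≡ᵇ 3)
      ≡⟨ ∑-𝟙[cycDist≡d] 3 (toℕ<n j) ⟩
    cycleSphere k 3 ∎
    where open ≡-Reasoning

  ∑-next-gon : ∀ {i i′} j → suc (toℕ i) ≡ toℕ i′ →
               ∑[ j′ < k ] 𝟙 (chainDist (i , j) (i′ , j′) ≡ᵇ 3) ≡ crossings k (cycDist k (toℕ j) (exit i))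
  ∑-next-gon {i} {i′} j e =
    trans (sum-cong-≗ {k} (λ j′ → cong (λ d → 𝟙 (d ≡ᵇ 3)) (chainDist-next i i′ j j′ e)))
          (∑-crossings (cycDist k (toℕ j) (exit i)) (toℕ<n (a i′)))

  ∑-prev-gon : ∀ {i i′} j → suc (toℕ i′) ≡ toℕ i →
               ∑[ j′ < k ] 𝟙 (chainDist (i , j) (i′ , j′) ≡ᵇ 3) ≡ crossings k (cycDist k (toℕ j) (entry i))
  ∑-prev-gon {i} {i′} j e =
    trans (sum-cong-≗ {k} (λ j′ → cong (λ d → 𝟙 (d ≡ᵇ 3)) (chainDist-prev i i′ j j′ e)))
          (∑-crossings (cycDist k (toℕ j) (entry i)) (toℕ<n (b i′)))

  ∑-layer : ∀ i j i′ → ∑[ j′ < k ] 𝟙 (chainDist (i , j) (i′ , j′) ≡ᵇ 3) ≡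
      (if toℕ i′ ≡ᵇ toℕ i then cycleSphere k 3 else 0)
    + (if toℕ i′ ≡ᵇ suc (toℕ i) then crossings k (cycDist k (toℕ j) (exit i)) else 0)
    + (if toℕ i′ + 1 ≡ᵇ toℕ i then crossings k (cycDist k (toℕ j) (entry i)) else 0)
  ∑-layer i j i′ with offset (toℕ i) (toℕ i′)
  ... | same e
    rewrite dec-true (toℕ i′ ≟ toℕ i) (sym e)
          | dec-false (toℕ i′ ≟ suc (toℕ i)) (λ e′ → 1+n≢n (trans (sym e′) (sym e)))
          | dec-false (toℕ i′ + 1 ≟ toℕ i) (λ e′ → 1+n≢n (trans (trans (+-comm 1 _) e′) e)) =
    trans (∑-same-gon j e) (sym (trans (+-identityʳ (cycleSphere k 3 + 0)) (+-identityʳ (cycleSphere k 3))))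
  ... | next e
    rewrite dec-false (toℕ i′ ≟ toℕ i) (λ e′ → 1+n≢n (trans e e′))
          | dec-true (toℕ i′ ≟ suc (toℕ i)) (sym e)
          | dec-false (toℕ i′ + 1 ≟ toℕ i)
                      (λ e′ → >⇒≢ (n≤1+n (suc (toℕ i))) (trans (cong suc e) (trans (+-comm 1 _) e′))) =
    trans (∑-next-gon j e) (sym (+-identityʳ _))
  ... | prev e
    rewrite dec-false (toℕ i′ ≟ toℕ i) (λ e′ → 1+n≢n (trans e (sym e′)))
          | dec-false (toℕ i′ ≟ suc (toℕ i)) (λ e′ → >⇒≢ (n≤1+n (suc (toℕ i))) (trans (cong suc (sym e′)) e))
          | dec-true (toℕ i′ + 1 ≟ toℕ i) (trans (+-comm _ 1) e) =
    ∑-prev-gon j e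
  ... | far e₀ e₁ e₂
    rewrite dec-false (toℕ i′ ≟ toℕ i) (e₀ ∘ sym)
          | dec-false (toℕ i′ ≟ suc (toℕ i)) (e₁ ∘ sym)
          | dec-false (toℕ i′ + 1 ≟ toℕ i) (e₂ ∘ trans (+-comm 1 _)) =
    trans (sum-cong-≗ {k} (λ j′ → cong (λ d → 𝟙 (d ≡ᵇ 3)) (chainDist-far i i′ j j′ e₀ e₁ e₂)))
          (sum-replicate-zero k)

  ∑-row : ∀ i j → ∑[ i′ < h ] ∑[ j′ < k ] 𝟙 (chainDist (i , j) (i′ , j′) ≡ᵇ 3) ≡
      cycleSphere k 3
    + crossings k (cycDist k (toℕ j) (exit i)) * 𝟙 (suc (toℕ i) <ᵇ h)
    + crossings k (cycDist k (toℕ j) (entry i)) * 𝟙 (1 ≤ᵇ toℕ i)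
  ∑-row i j = begin
    ∑[ i′ < h ] ∑[ j′ < k ] 𝟙 (chainDist (i , j) (i′ , j′) ≡ᵇ 3)
      ≡⟨ sum-cong-≗ {h} (∑-layer i j) ⟩
    ∑[ i′ < h ] (ite₁ i′ + ite₂ i′ + ite₃ i′)
      ≡⟨ ∑-distrib-+₃ h ite₁ ite₂ ite₃ ⟩
    ∑[ i′ < h ] ite₁ i′ + ∑[ i′ < h ] ite₂ i′ + ∑[ i′ < h ] ite₃ i′
      ≡⟨ cong₂ _+_ (cong₂ _+_ (∑-if h s₃ (λ i′ → toℕ i′ ≡ᵇ toℕ i)) (∑-if h X (λ i′ → toℕ i′ ≡ᵇ suc (toℕ i))))
                   (∑-if h Y (λ i′ → toℕ i′ + 1 ≡ᵇ toℕ i)) ⟩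
    s₃ * ∑[ i′ < h ] 𝟙 (toℕ i′ ≡ᵇ toℕ i) + X * ∑[ i′ < h ] 𝟙 (toℕ i′ ≡ᵇ suc (toℕ i))
      + Y * ∑[ i′ < h ] 𝟙 (toℕ i′ + 1 ≡ᵇ toℕ i)
      ≡⟨ cong₂ _+_ (cong₂ _+_ (cong (s₃ *_) (trans (∑-𝟙[i≡t] h (toℕ i)) (𝟙-yes (toℕ i <? h) (toℕ<n i))))
                              (cong (X *_) (∑-𝟙[i≡t] h (suc (toℕ i)))))
                   (cong (Y *_) (∑-𝟙[i+e≡c] h 1 (toℕ<n i))) ⟩
    s₃ * 1 + X * 𝟙 (suc (toℕ i) <ᵇ h) + Y * 𝟙 (1 ≤ᵇ toℕ i)
      ≡⟨ cong (λ t → t + X * 𝟙 (suc (toℕ i) <ᵇ h) + Y * 𝟙 (1 ≤ᵇ toℕ i)) (*-identityʳ s₃) ⟩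
    s₃ + X * 𝟙 (suc (toℕ i) <ᵇ h) + Y * 𝟙 (1 ≤ᵇ toℕ i) ∎
    where
    open ≡-Reasoning
    s₃ = cycleSphere k 3
    X = crossings k (cycDist k (toℕ j) (exit i))
    Y = crossings k (cycDist k (toℕ j) (entry i))
    ite₁ ite₂ ite₃ : Fin h → ℕ
    ite₁ i′ = if toℕ i′ ≡ᵇ toℕ i then s₃ else 0
    ite₂ i′ = if toℕ i′ ≡ᵇ suc (toℕ i) then X else 0
    ite₃ i′ = if toℕ i′ + 1 ≡ᵇ toℕ i then Y else 0

  ∑-gon : ∀ i → ∑[ j < k ] ∑[ i′ < h ] ∑[ j′ < k ] 𝟙 (chainDist (i , j) (i′ , j′) ≡ᵇ 3) ≡
      k * cycleSphere k 3 + acrossBridge k * 𝟙 (suc (toℕ i) <ᵇ h) + acrossBridge k * 𝟙 (1 ≤ᵇ toℕ i)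
  ∑-gon i = begin
    ∑[ j < k ] ∑[ i′ < h ] ∑[ j′ < k ] 𝟙 (chainDist (i , j) (i′ , j′) ≡ᵇ 3)
      ≡⟨ sum-cong-≗ {k} (∑-row i) ⟩
    ∑[ j < k ] (s₃ + X j * α + Y j * β)
      ≡⟨ ∑-distrib-+₃ k (λ _ → s₃) (λ j → X j * α) (λ j → Y j * β) ⟩
    ∑[ j < k ] s₃ + ∑[ j < k ] (X j * α) + ∑[ j < k ] (Y j * β)
      ≡⟨ cong₂ _+_ (cong₂ _+_ (∑-const k s₃) (sym (*-distribʳ-sum α X))) (sym (*-distribʳ-sum β Y)) ⟩
    k * s₃ + ∑[ j < k ] X j * α + ∑[ j < k ] Y j * β
      ≡⟨ cong₂ (λ x y → k * s₃ + x * α + y * β) (∑-cycDist≤2 (crossings k) (λ _ → refl) (toℕ<n (b i)))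
                                                 (∑-cycDist≤2 (crossings k) (λ _ → refl) (toℕ<n (a i))) ⟩
    k * s₃ + acrossBridge k * α + acrossBridge k * β ∎
    where
    open ≡-Reasoning
    s₃ = cycleSphere k 3
    α = 𝟙 (suc (toℕ i) <ᵇ h)
    β = 𝟙 (1 ≤ᵇ toℕ i)
    X Y : Fin k → ℕ
    X j = crossings k (cycDist k (toℕ j) (exit i))
    Y j = crossings k (cycDist k (toℕ j) (entry i))

  ∑-all : ∑[ i < h ] ∑[ j < k ] ∑[ i′ < h ] ∑[ j′ < k ] 𝟙 (chainDist (i , j) (i′ , j′) ≡ᵇ 3) ≡
      h * (k * cycleSphere k 3) + acrossBridge k * (h ∸ 1) + acrossBridge k * (h ∸ 1)
  ∑-all = begin
    ∑[ i < h ] ∑[ j < k ] ∑[ i′ < h ] ∑[ j′ < k ] 𝟙 (chainDist (i , j) (i′ , j′) ≡ᵇ 3)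
      ≡⟨ sum-cong-≗ {h} ∑-gon ⟩
    ∑[ i < h ] (k * s₃ + E * α i + E * β i)
      ≡⟨ ∑-distrib-+₃ h (λ _ → k * s₃) (λ i → E * α i) (λ i → E * β i) ⟩
    ∑[ i < h ] (k * s₃) + ∑[ i < h ] (E * α i) + ∑[ i < h ] (E * β i)
      ≡⟨ cong₂ _+_ (cong₂ _+_ (∑-const h (k * s₃)) (sym (*-distribˡ-sum E α))) (sym (*-distribˡ-sum E β)) ⟩
    h * (k * s₃) + E * ∑[ i < h ] α i + E * ∑[ i < h ] β i
      ≡⟨ cong₂ (λ x y → h * (k * s₃) + E * x + E * y) (∑-𝟙[i+1<n] h) (∑-𝟙[1≤i] h) ⟩
    h * (k * s₃) + E * (h ∸ 1) + E * (h ∸ 1) ∎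
    where
    open ≡-Reasoning
    s₃ = cycleSphere k 3
    E = acrossBridge k
    α β : Fin h → ℕ
    α i = 𝟙 (suc (toℕ i) <ᵇ h)
    β i = 𝟙 (1 ≤ᵇ toℕ i)

double-wienerPolarity-metaChain : ∀ k h (a b : Fin h → Fin k) → TypeTwo k h a b →
  2 * wienerPolarity (metaChainAdj k h a b) ≡ h * k * cycleSphere k 3 + 2 * (h ∸ 1) * acrossBridge k
double-wienerPolarity-metaChain k h a b t2 = begin
  2 * W                                                              ≡⟨ cong (W +_) (+-identityʳ W) ⟩
  W + W                                                              ≡⟨ cong₂ _+_ W≡N W≡N ⟩
  N + N                                                              ≡⟨ ∑∑-unordered (h * k) P P-comm P-irrefl ⟩
  ∑[ u < h * k ] ∑[ v < h * k ] 𝟙 (P u v)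
    ≡⟨ sum-cong-≗ {h * k} (λ u → sum-cong-≗ {h * k} (λ v → cong 𝟙 (dist3≡chainDist≡3 t2 u v))) ⟩
  ∑[ u < h * k ] ∑[ v < h * k ] 𝟙 (chainDist (remQuot k u) (remQuot k v) ≡ᵇ 3)
    ≡⟨ ∑-remQuot h k (λ p → ∑[ v < h * k ] 𝟙 (chainDist p (remQuot k v) ≡ᵇ 3)) ⟩
  ∑[ i < h ] ∑[ j < k ] ∑[ v < h * k ] 𝟙 (chainDist (i , j) (remQuot k v) ≡ᵇ 3)
    ≡⟨ sum-cong-≗ {h} (λ i → sum-cong-≗ {k} (λ j → ∑-remQuot h k (λ q → 𝟙 (chainDist (i , j) q ≡ᵇ 3)))) ⟩
  ∑[ i < h ] ∑[ j < k ] ∑[ i′ < h ] ∑[ j′ < k ] 𝟙 (chainDist (i , j) (i′ , j′) ≡ᵇ 3)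
    ≡⟨ ∑-all ⟩
  h * (k * cycleSphere k 3) + acrossBridge k * (h ∸ 1) + acrossBridge k * (h ∸ 1)
    ≡⟨ regroup h k (cycleSphere k 3) (h ∸ 1) (acrossBridge k) ⟩
  h * k * cycleSphere k 3 + 2 * (h ∸ 1) * acrossBridge k ∎
  where
  open ≡-Reasoning
  open MetaChain k h a b
  W = wienerPolarity (metaChainAdj k h a b)
  P : Fin (h * k) → Fin (h * k) → Bool
  P = dist3 (metaChainAdj k h a b)
  N = ∑[ u < h * k ] ∑[ v < h * k ] 𝟙 ((toℕ u <ᵇ toℕ v) ∧ P u v)
  W≡N : W ≡ N
  W≡N = trans (listSum-allFin (h * k) _) (sum-cong-≗ {h * k} (λ u → listSum-allFin (h * k) _))
  P-comm : ∀ u v → P u v ≡ P v u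
  P-comm u v = trans (dist3≡chainDist≡3 t2 u v)
    (trans (cong (_≡ᵇ 3) (chainDist-comm (remQuot k u) (remQuot k v))) (sym (dist3≡chainDist≡3 t2 v u)))
  P-irrefl : ∀ u → P u u ≡ false
  P-irrefl u = trans (dist3≡chainDist≡3 t2 u u) (cong (_≡ᵇ 3) (chainDist-self (remQuot k u)))
  regroup : ∀ h k s m e → h * (k * s) + e * m + e * m ≡ h * k * s + 2 * m * e
  regroup = solve-∀

corollary2p6 : (k h : ℕ) → 4 ≤ k → 2 ≤ h → (a b : Fin h → Fin k) → TypeTwo k h a b →
    ((k ≡ 4 → wienerPolarity (metaChainAdj k h a b) ≡ 6 * h ∸ 6)
   × (k ≡ 5 → wienerPolarity (metaChainAdj k h a b) ≡ 8 * h ∸ 8)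
   × (k ≡ 6 → wienerPolarity (metaChainAdj k h a b) ≡ 11 * h ∸ 8)
   × (7 ≤ k → wienerPolarity (metaChainAdj k h a b) ≡ (k + 8) * h ∸ 8))
corollary2p6 k (suc h) _ (s≤s _) a b t2 =
    (λ { refl → halve (6 * h) (square₄ h) (∸-from 6 (*-suc 6 h)) })
  , (λ { refl → halve (8 * h) (square₅ h) (∸-from 8 (*-suc 8 h)) })
  , (λ { refl → halve (3 + 11 * h) (square₆ h) (∸-from 8 (target₆ h)) })
  , (λ 7≤k → halve (k * suc h + 8 * h) (squareₖ 7≤k) (∸-from 8 (targetₖ h k)))
  where
  W = wienerPolarity (metaChainAdj k (suc h) a b)
  halve : ∀ {t} x → suc h * k * cycleSphere k 3 + 2 * h * acrossBridge k ≡ 2 * x → t ≡ x → W ≡ t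
  halve x 2W≡2x t≡x =
    trans (*-cancelˡ-≡ W x 2 (trans (double-wienerPolarity-metaChain k (suc h) a b t2) 2W≡2x)) (sym t≡x)
  ∸-from : ∀ {m} d {n} → m ≡ d + n → m ∸ d ≡ n
  ∸-from d {n} m≡d+n = trans (cong (_∸ d) m≡d+n) (m+n∸m≡n d n)
  square₄ : ∀ h → suc h * 4 * 0 + 2 * h * 6 ≡ 2 * (6 * h)
  square₄ = solve-∀
  square₅ : ∀ h → suc h * 5 * 0 + 2 * h * 8 ≡ 2 * (8 * h)
  square₅ = solve-∀
  square₆ : ∀ h → suc h * 6 * 1 + 2 * h * 8 ≡ 2 * (3 + 11 * h)
  square₆ = solve-∀
  target₆ : ∀ h → 11 * suc h ≡ 8 + (3 + 11 * h)
  target₆ = solve-∀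
  targetₖ : ∀ h k → (k + 8) * suc h ≡ 8 + (k * suc h + 8 * h)
  targetₖ = solve-∀
  squareₖ : 7 ≤ k → suc h * k * cycleSphere k 3 + 2 * h * acrossBridge k ≡ 2 * (k * suc h + 8 * h)
  squareₖ 7≤k rewrite cycleSphere-interior 0 (≤-trans (m≤m+n 3 4) 7≤k)
                    | cycleSphere-interior 1 (≤-trans (m≤m+n 5 2) 7≤k)
                    | cycleSphere-interior 2 7≤k = squareₖ′ (suc h) h k
    where
    squareₖ′ : ∀ H h k → H * k * 2 + 2 * h * (2 * 1 + 2 * 2 + 1 * 2) ≡ 2 * (k * H + 8 * h)
    squareₖ′ = solve-∀
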